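{- Let $a,b,m,s$ be positive integers with $3\leq s\leq m$ such that either $s$ is even or $m$ is odd, and such that $a\equiv b \pmod 2$, $a+b>5$, and $a,b>1$. Then there exists a magic rectangle $MR(am,bm;bs,as)$.
   Context: For positive integers $m,n,r,s$ with $mr=ns$, $r\le n$, $s\le m$, a magic rectangle $MR(m,n;r,s)$ is an $m\times n$ array in which some cells may be empty, each row contains exactly $r$ filled cells, each column contains exactly $s$ filled cells, the filled cells contain the numbers $0,1,\ldots,mr-1$, each exactly once, the sum of the entries of each row is the same for all rows, and the sum of the entries of each column is the same for all columns. -}

module Defs where

open import Data.Nat using (ℕ; zero; suc; _+_; _*_; _≤_)
open import Data.Fin using (Fin; toℕ) renaming (zero to fzero; suc to fsuc)
open import Data.Maybe using (Maybe; just; nothing)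
open import Data.Product using (Σ; _×_; ∃; ∃-syntax; _,_)
open import Relation.Binary.PropositionalEquality using (_≡_)

∑ : (n : ℕ) → (Fin n → ℕ) → ℕ
∑ zero    f = 0
∑ (suc n) f = f fzero + ∑ n (λ i → f (fsuc i))

filled : ∀ {k} → Maybe (Fin k) → ℕ
filled (just _) = 1
filled nothing  = 0

val : ∀ {k} → Maybe (Fin k) → ℕ
val (just x) = toℕ x
val nothing  = 0

Array : ℕ → ℕ → ℕ → Set
Array m n N = Fin m → Fin n → Maybe (Fin N)

-- A magic rectangle MR(m,n;r,s) (with m*r ≡ n*s, r ≤ n, s ≤ m).
record IsMagicRectangle (m n r s : ℕ) (A : Array m n (m * r)) : Set where
  field
    rowCount  : ∀ i → ∑ n (λ j → filled (A i j)) ≡ r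
    colCount  : ∀ j → ∑ m (λ i → filled (A i j)) ≡ s
    occurs    : ∀ (x : Fin (m * r)) → ∃[ i ] ∃[ j ] (A i j ≡ just x)
    once      : ∀ i j i' j' (x : Fin (m * r)) →
                A i j ≡ just x → A i' j' ≡ just x → (i ≡ i') × (j ≡ j')
    rowSum    : ∀ i i' → ∑ n (λ j → val (A i j)) ≡ ∑ n (λ j → val (A i' j))
    colSum    : ∀ j j' → ∑ m (λ i → val (A i j)) ≡ ∑ m (λ i → val (A i j'))

MagicRectangle : ℕ → ℕ → ℕ → ℕ → Set
MagicRectangle m n r s = Σ (Array m n (m * r)) (IsMagicRectangle m n r s)

-- Index the rows of the (a·m) × (b·m) array as i₂·m + i₁ and its columns as j₂·m + j₁, and fill
-- exactly the cells of the cyclic band t = j₁ − i₁ mod m < s; then every row meets b·s and every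
-- column a·s filled cells.  The cell with offset t receives the number with mixed-radix digits
-- (t, h, y, x) ∈ [s] × [m] × [a] × [b], where for each t the map (i₁, i₂, j₂) ↦ (h, y, x) is a
-- permutation, so the entries are 0, …, a·m·b·s − 1, each exactly once.  It remains to choose
-- the permutations so that the digits h, y, x have constant sums along rows and columns.
-- If a, b, m are odd, h, y, x are affine images of i₁, i₂, j₂ taken from Kotzig arrays over
-- ℤ/m, ℤ/a, ℤ/b; a column reads the ℤ/m array along a descending diagonal i₁ = j₁ − t, where its
-- sums are constant too.  If a, b are even, h is i₁ reflected on one colour class of the
-- checkerboard i₂ + j₂, and (y, x) runs through reflections of the a × b grid that cancel in pairs
-- (with one balanced triple when s is odd).  The remaining case, a, b odd and m, s even, is the
-- even construction for 2a, 2b, m/2, s/2.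

module Submission where

open import Defs
open import Data.Bool using (Bool; true; false; if_then_else_; not; T)
open import Data.Empty using (⊥-elim)
open import Data.Fin using (Fin; toℕ; fromℕ<) renaming (zero to fzero; suc to fsuc)
open import Data.Fin.Properties using (toℕ<n; toℕ-fromℕ<; toℕ-injective)
open import Data.Maybe using (Maybe; just; nothing)
open import Data.Nat
open import Data.Nat.DivMod
open import Data.Nat.Properties
open import Data.Nat.Tactic.RingSolver using (solve-∀)
open import Data.Product using (_,_; _×_; proj₁; proj₂; ∃-syntax)
open import Data.Sum using (_⊎_; inj₁; inj₂; [_,_]′)
open import Data.Unit using (tt)
open import Relation.Binary.PropositionalEquality using (_≡_; refl; sym; trans; cong; cong₂; subst; module ≡-Reasoning)
open import Relation.Nullary using (yes; no; ¬_)
open ≡-Reasoning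

sumTo : ℕ → (ℕ → ℕ) → ℕ
sumTo zero    f = 0
sumTo (suc n) f = f 0 + sumTo n (λ i → f (suc i))

∑≡sumTo : ∀ n (f : ℕ → ℕ) → ∑ n (λ i → f (toℕ i)) ≡ sumTo n f
∑≡sumTo zero    f = refl
∑≡sumTo (suc n) f = cong (f 0 +_) (∑≡sumTo n (λ i → f (suc i)))

∑-cong : ∀ n {f g : Fin n → ℕ} → (∀ i → f i ≡ g i) → ∑ n f ≡ ∑ n g
∑-cong zero    eq = refl
∑-cong (suc n) eq = cong₂ _+_ (eq fzero) (∑-cong n (λ i → eq (fsuc i)))

sumTo-cong : ∀ n {f g : ℕ → ℕ} → (∀ i → i < n → f i ≡ g i) → sumTo n f ≡ sumTo n g
sumTo-cong zero    eq = refl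
sumTo-cong (suc n) eq = cong₂ _+_ (eq 0 z<s) (sumTo-cong n (λ i i<n → eq (suc i) (s<s i<n)))

sumTo-+ : ∀ n (f g : ℕ → ℕ) → sumTo n (λ i → f i + g i) ≡ sumTo n f + sumTo n g
sumTo-+ zero    f g = refl
sumTo-+ (suc n) f g = begin
  f 0 + g 0 + sumTo n (λ i → f (suc i) + g (suc i))
    ≡⟨ cong (f 0 + g 0 +_) (sumTo-+ n (λ i → f (suc i)) (λ i → g (suc i))) ⟩
  f 0 + g 0 + (sumTo n (λ i → f (suc i)) + sumTo n (λ i → g (suc i)))
    ≡⟨ +-interchange (f 0) (g 0) _ _ ⟩
  f 0 + sumTo n (λ i → f (suc i)) + (g 0 + sumTo n (λ i → g (suc i))) ∎
  where
  +-interchange : ∀ a b c d → a + b + (c + d) ≡ a + c + (b + d)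
  +-interchange = solve-∀

sumTo-+₃ : ∀ n (f g h : ℕ → ℕ) →
           sumTo n (λ i → f i + g i + h i) ≡ sumTo n f + sumTo n g + sumTo n h
sumTo-+₃ n f g h = trans (sumTo-+ n (λ i → f i + g i) h) (cong (_+ sumTo n h) (sumTo-+ n f g))

sumTo-*ˡ : ∀ n c (f : ℕ → ℕ) → sumTo n (λ i → c * f i) ≡ c * sumTo n f
sumTo-*ˡ zero    c f = sym (*-zeroʳ c)
sumTo-*ˡ (suc n) c f = begin
  c * f 0 + sumTo n (λ i → c * f (suc i)) ≡⟨ cong (c * f 0 +_) (sumTo-*ˡ n c (λ i → f (suc i))) ⟩
  c * f 0 + c * sumTo n (λ i → f (suc i)) ≡⟨ *-distribˡ-+ c (f 0) _ ⟨
  c * (f 0 + sumTo n (λ i → f (suc i)))   ∎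

sumTo-*ʳ : ∀ n (f : ℕ → ℕ) c → sumTo n (λ i → f i * c) ≡ sumTo n f * c
sumTo-*ʳ n f c = begin
  sumTo n (λ i → f i * c) ≡⟨ sumTo-cong n (λ i _ → *-comm (f i) c) ⟩
  sumTo n (λ i → c * f i) ≡⟨ sumTo-*ˡ n c f ⟩
  c * sumTo n f           ≡⟨ *-comm c _ ⟩
  sumTo n f * c           ∎

sumTo-const : ∀ n c → sumTo n (λ _ → c) ≡ n * c
sumTo-const zero    c = refl
sumTo-const (suc n) c = cong (c +_) (sumTo-const n c)

sumTo-zero : ∀ n → sumTo n (λ _ → 0) ≡ 0
sumTo-zero n = trans (sumTo-const n 0) (*-zeroʳ n)

sumTo-++ : ∀ m n (f : ℕ → ℕ) → sumTo (m + n) f ≡ sumTo m f + sumTo n (λ i → f (m + i))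
sumTo-++ zero    n f = refl
sumTo-++ (suc m) n f = trans (cong (f 0 +_) (sumTo-++ m n (λ i → f (suc i))))
                             (sym (+-assoc (f 0) _ _))

sumTo-last : ∀ n (f : ℕ → ℕ) → sumTo (suc n) f ≡ sumTo n f + f n
sumTo-last n f = begin
  sumTo (suc n) f               ≡⟨ cong (λ k → sumTo k f) (+-comm 1 n) ⟩
  sumTo (n + 1) f               ≡⟨ sumTo-++ n 1 f ⟩
  sumTo n f + (f (n + 0) + 0)   ≡⟨ cong (sumTo n f +_) (trans (+-identityʳ _) (cong f (+-identityʳ n))) ⟩
  sumTo n f + f n               ∎

sumTo-swap : ∀ m n (f : ℕ → ℕ → ℕ) →
  sumTo m (λ i → sumTo n (λ j → f i j)) ≡ sumTo n (λ j → sumTo m (λ i → f i j))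
sumTo-swap zero    n f = sym (sumTo-zero n)
sumTo-swap (suc m) n f = begin
  sumTo n (f 0) + sumTo m (λ i → sumTo n (f (suc i)))
    ≡⟨ cong (sumTo n (f 0) +_) (sumTo-swap m n (λ i → f (suc i))) ⟩
  sumTo n (f 0) + sumTo n (λ j → sumTo m (λ i → f (suc i) j))
    ≡⟨ sumTo-+ n (f 0) (λ j → sumTo m (λ i → f (suc i) j)) ⟨
  sumTo n (λ j → f 0 j + sumTo m (λ i → f (suc i) j)) ∎

sumTo-blocks : ∀ b m (f : ℕ → ℕ) → sumTo (b * m) f ≡ sumTo b (λ q → sumTo m (λ r → f (q * m + r)))
sumTo-blocks zero    m f = refl
sumTo-blocks (suc b) m f = begin
  sumTo (m + b * m) f
    ≡⟨ sumTo-++ m (b * m) f ⟩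
  sumTo m f + sumTo (b * m) (λ i → f (m + i))
    ≡⟨ cong (sumTo m f +_) (sumTo-blocks b m (λ i → f (m + i))) ⟩
  sumTo m f + sumTo b (λ q → sumTo m (λ r → f (m + (q * m + r))))
    ≡⟨ cong (sumTo m f +_) (sumTo-cong b (λ q _ → sumTo-cong m (λ r _ → cong f (sym (+-assoc m (q * m) r))))) ⟩
  sumTo m f + sumTo b (λ q → sumTo m (λ r → f (suc q * m + r))) ∎

sumTo-reverse : ∀ n (f : ℕ → ℕ) → sumTo n (λ j → f (n ∸ suc j)) ≡ sumTo n f
sumTo-reverse zero    f = refl
sumTo-reverse (suc n) f = begin
  f n + sumTo n (λ j → f (n ∸ suc j)) ≡⟨ cong (f n +_) (sumTo-reverse n f) ⟩
  f n + sumTo n f                     ≡⟨ +-comm (f n) _ ⟩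
  sumTo n f + f n                     ≡⟨ sumTo-last n f ⟨
  sumTo (suc n) f                     ∎

sumTo-rotate₁ : ∀ n .{{_ : NonZero n}} (f : ℕ → ℕ) → sumTo n (λ j → f (suc j % n)) ≡ sumTo n f
sumTo-rotate₁ (suc n) f = begin
  sumTo (suc n) (λ j → f (suc j % suc n))
    ≡⟨ sumTo-last n _ ⟩
  sumTo n (λ j → f (suc j % suc n)) + f (suc n % suc n)
    ≡⟨ cong₂ _+_ (sumTo-cong n (λ j j<n → cong f (m<n⇒m%n≡m (s<s j<n)))) (cong f (n%n≡0 (suc n))) ⟩
  sumTo n (λ j → f (suc j)) + f 0
    ≡⟨ +-comm _ (f 0) ⟩
  sumTo (suc n) f ∎

sumTo-rotate : ∀ n .{{_ : NonZero n}} k (f : ℕ → ℕ) → sumTo n (λ j → f ((j + k) % n)) ≡ sumTo n f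
sumTo-rotate n zero    f = sumTo-cong n (λ j j<n → cong f (trans (cong (_% n) (+-identityʳ j)) (m<n⇒m%n≡m j<n)))
sumTo-rotate n (suc k) f = begin
  sumTo n (λ j → f ((j + suc k) % n)) ≡⟨ sumTo-cong n (λ j _ → cong f (shift j)) ⟩
  sumTo n (λ j → f ((suc j % n + k) % n)) ≡⟨ sumTo-rotate₁ n (λ x → f ((x + k) % n)) ⟩
  sumTo n (λ j → f ((j + k) % n)) ≡⟨ sumTo-rotate n k f ⟩
  sumTo n f ∎
  where
  shift : ∀ j → (j + suc k) % n ≡ (suc j % n + k) % n
  shift j = begin
    (j + suc k) % n               ≡⟨ cong (_% n) (+-suc j k) ⟩
    (suc j + k) % n               ≡⟨ %-distribˡ-+ (suc j) k n ⟩
    (suc j % n + k % n) % n       ≡⟨ cong (λ z → (z + k % n) % n) (m%n%n≡m%n (suc j) n) ⟨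
    (suc j % n % n + k % n) % n   ≡⟨ %-distribˡ-+ (suc j % n) k n ⟨
    (suc j % n + k) % n           ∎

<ᵇ-true : ∀ {m n} → m < n → (m <ᵇ n) ≡ true
<ᵇ-true {m} {n} m<n with m <ᵇ n | <⇒<ᵇ m<n
... | true | _ = refl

<ᵇ-false : ∀ {m n} → ¬ m < n → (m <ᵇ n) ≡ false
<ᵇ-false {m} {n} m≮n with m <ᵇ n in eq
... | false = refl
... | true  = ⊥-elim (m≮n (<ᵇ⇒< m n (subst T (sym eq) tt)))

sumTo-truncate : ∀ s n (f : ℕ → ℕ) → s ≤ n →
  sumTo n (λ t → if t <ᵇ s then f t else 0) ≡ sumTo s f
sumTo-truncate s n f s≤n = begin
  sumTo n g
    ≡⟨ cong (λ k → sumTo k g) (m+[n∸m]≡n s≤n) ⟨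
  sumTo (s + (n ∸ s)) g
    ≡⟨ sumTo-++ s (n ∸ s) g ⟩
  sumTo s g + sumTo (n ∸ s) (λ i → g (s + i))
    ≡⟨ cong₂ _+_ (sumTo-cong s (λ t t<s → cong (λ b → if b then f t else 0) (<ᵇ-true t<s)))
                 (trans (sumTo-cong (n ∸ s) (λ i _ → cong (λ b → if b then f (s + i) else 0)
                                                         (<ᵇ-false (≤⇒≯ (m≤m+n s i)))))
                        (sumTo-zero (n ∸ s))) ⟩
  sumTo s f + 0
    ≡⟨ +-identityʳ _ ⟩
  sumTo s f ∎
  where
  g : ℕ → ℕ
  g t = if t <ᵇ s then f t else 0

sumTo-nested-const : ∀ s k (f : ℕ → ℕ) → sumTo s (λ t → sumTo k (λ _ → f t)) ≡ k * sumTo s f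
sumTo-nested-const s k f = trans (sumTo-cong s (λ t _ → sumTo-const k (f t))) (sumTo-*ˡ s k f)

sumTo-*+ : ∀ n (f g : ℕ → ℕ) k → sumTo n (λ j → f j * k + g j) ≡ sumTo n f * k + sumTo n g
sumTo-*+ n f g k = trans (sumTo-+ n (λ j → f j * k) g) (cong (_+ sumTo n g) (sumTo-*ʳ n f k))

cong₃ : ∀ {X Y Z W : Set} (f : X → Y → Z → W) {x x′ y y′ z z′} → x ≡ x′ → y ≡ y′ → z ≡ z′ → f x y z ≡ f x′ y′ z′
cong₃ f refl refl refl = refl

module Modulo (n : ℕ) .{{_ : NonZero n}} where

  infix 4 _≋_
  record _≋_ (a b : ℕ) : Set where
    constructor mk≋
    field un≋ : a % n ≡ b % n

  ≋-refl : ∀ {a} → a ≋ a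
  ≋-refl = mk≋ refl

  ≋-sym : ∀ {a b} → a ≋ b → b ≋ a
  ≋-sym (mk≋ p) = mk≋ (sym p)

  ≋-trans : ∀ {a b c} → a ≋ b → b ≋ c → a ≋ c
  ≋-trans (mk≋ p) (mk≋ q) = mk≋ (trans p q)

  ≡⇒≋ : ∀ {a b} → a ≡ b → a ≋ b
  ≡⇒≋ refl = ≋-refl

  ≋-+ : ∀ {a a′ b b′} → a ≋ a′ → b ≋ b′ → a + b ≋ a′ + b′
  ≋-+ {a} {a′} {b} {b′} (mk≋ p) (mk≋ q) = mk≋ (begin
    (a + b) % n             ≡⟨ %-distribˡ-+ a b n ⟩
    (a % n + b % n) % n     ≡⟨ cong₂ (λ x y → (x + y) % n) p q ⟩
    (a′ % n + b′ % n) % n   ≡⟨ %-distribˡ-+ a′ b′ n ⟨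
    (a′ + b′) % n           ∎)

  ≋-* : ∀ {a a′ b b′} → a ≋ a′ → b ≋ b′ → a * b ≋ a′ * b′
  ≋-* {a} {a′} {b} {b′} (mk≋ p) (mk≋ q) = mk≋ (begin
    (a * b) % n               ≡⟨ %-distribˡ-* a b n ⟩
    (a % n * (b % n)) % n     ≡⟨ cong₂ (λ x y → (x * y) % n) p q ⟩
    (a′ % n * (b′ % n)) % n   ≡⟨ %-distribˡ-* a′ b′ n ⟨
    (a′ * b′) % n             ∎)

  ≋-+ˡ : ∀ {b b′} a → b ≋ b′ → a + b ≋ a + b′
  ≋-+ˡ a = ≋-+ (≋-refl {a})

  ≋-+ʳ : ∀ {a a′} b → a ≋ a′ → a + b ≋ a′ + b
  ≋-+ʳ b p = ≋-+ p (≋-refl {b})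

  ≋-*ˡ : ∀ {b b′} a → b ≋ b′ → a * b ≋ a * b′
  ≋-*ˡ a = ≋-* (≋-refl {a})

  %≋ : ∀ a → a % n ≋ a
  %≋ a = mk≋ (m%n%n≡m%n a n)

  +kn≋ : ∀ a k → a + k * n ≋ a
  +kn≋ a k = mk≋ ([m+kn]%n≡m%n a k n)

  kn≋0 : ∀ k → k * n ≋ 0
  kn≋0 = +kn≋ 0

  n≋0 : n ≋ 0
  n≋0 = ≋-trans (≡⇒≋ (sym (*-identityˡ n))) (kn≋0 1)

  0%n≡0 : 0 % n ≡ 0
  0%n≡0 = m<n⇒m%n≡m (>-nonZero⁻¹ n)

  ≋⇒%≡ : ∀ {a b} → a ≋ b → b < n → a % n ≡ b
  ≋⇒%≡ (mk≋ p) b<n = trans p (m<n⇒m%n≡m b<n)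

  ≋-cancel+ʳ : ∀ {a b} k → a + k ≋ b + k → a ≋ b
  ≋-cancel+ʳ {a} {b} k p =
    ≋-trans (≋-sym (+kn≋ a k)) (≋-trans (≡⇒≋ (complete a))
      (≋-trans (≋-+ʳ (k * n ∸ k) p) (≋-trans (≡⇒≋ (sym (complete b))) (+kn≋ b k))))
    where
    complete : ∀ x → x + k * n ≡ x + k + (k * n ∸ k)
    complete x = trans (cong (x +_) (sym (m+[n∸m]≡n (m≤m*n k n)))) (sym (+-assoc x k _))

  ≋0⇒≡n : ∀ {s} → s ≋ 0 → 0 < s → s < n + n → s ≡ n
  ≋0⇒≡n {s} (mk≋ p) 0<s s<2n with s <? n
  ... | yes s<n = ⊥-elim (<⇒≢ 0<s (sym (trans (sym (m<n⇒m%n≡m s<n)) (trans p 0%n≡0))))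
  ... | no s≮n = begin
    s             ≡⟨ m+[n∸m]≡n n≤s ⟨
    n + (s ∸ n)   ≡⟨ cong (n +_) s∸n≡0 ⟩
    n + 0         ≡⟨ +-identityʳ n ⟩
    n             ∎
    where
    n≤s : n ≤ s
    n≤s = ≮⇒≥ s≮n
    s∸n<n : s ∸ n < n
    s∸n<n = +-cancelˡ-< n (s ∸ n) n (subst (_< n + n) (sym (m+[n∸m]≡n n≤s)) s<2n)
    s∸n≡0 : s ∸ n ≡ 0
    s∸n≡0 = begin
      s ∸ n         ≡⟨ m<n⇒m%n≡m s∸n<n ⟨
      (s ∸ n) % n   ≡⟨ m≤n⇒[n∸m]%m≡n%m n≤s ⟩
      s % n         ≡⟨ p ⟩
      0 % n         ≡⟨ 0%n≡0 ⟩
      0             ∎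

  residues-sum-to-n∸1 : ∀ x y → x + y + 1 ≋ 0 → x % n + y % n + 1 ≡ n
  residues-sum-to-n∸1 x y p = ≋0⇒≡n residues≋0 (subst (0 <_) (+-comm 1 _) z<s) bound
    where
    residues≋0 : x % n + y % n + 1 ≋ 0
    residues≋0 = ≋-trans (≋-+ʳ 1 (≋-+ (%≋ x) (%≋ y))) p
    bound : x % n + y % n + 1 < n + n
    bound = subst (_≤ n + n) (suc-+ (x % n) (y % n)) (+-mono-≤ (m%n<n x n) (m%n<n y n))
      where
      suc-+ : ∀ u v → suc u + suc v ≡ suc (u + v + 1)
      suc-+ = solve-∀

[q*d+r]%d≡r : ∀ q r d .{{_ : NonZero d}} → r < d → (q * d + r) % d ≡ r
[q*d+r]%d≡r q r d r<d = trans (cong (_% d) (+-comm (q * d) r)) (trans ([m+kn]%n≡m%n r q d) (m<n⇒m%n≡m r<d))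

[q*d+r]/d≡q : ∀ q r d .{{_ : NonZero d}} → r < d → (q * d + r) / d ≡ q
[q*d+r]/d≡q q r d r<d = *-cancelʳ-≡ _ _ d (+-cancelʳ-≡ r _ _ (begin
  (q * d + r) / d * d + r             ≡⟨ +-comm _ r ⟩
  r + (q * d + r) / d * d             ≡⟨ cong (_+ (q * d + r) / d * d) ([q*d+r]%d≡r q r d r<d) ⟨
  (q * d + r) % d + (q * d + r) / d * d ≡⟨ m≡m%n+[m/n]*n (q * d + r) d ⟨
  q * d + r                           ∎))

[m/d]*d+m%d≡m : ∀ m d .{{_ : NonZero d}} → m / d * d + m % d ≡ m
[m/d]*d+m%d≡m m d = trans (+-comm _ (m % d)) (sym (m≡m%n+[m/n]*n m d))

q*d+r<k*d : ∀ {q r k} d → r < d → q < k → q * d + r < k * d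
q*d+r<k*d {q} {r} {k} d r<d q<k =
  ≤-trans (+-monoʳ-< (q * d) r<d) (subst (_≤ k * d) (+-comm d (q * d)) (*-monoˡ-≤ d q<k))

module Cyclic (M : ℕ) .{{_ : NonZero M}} where
  open Modulo M

  infixl 6 _⊖_
  _⊖_ : ℕ → ℕ → ℕ
  j ⊖ i = (j + M ∸ i) % M

  ⊖< : ∀ j i → j ⊖ i < M
  ⊖< j i = m%n<n (j + M ∸ i) M

  private
    ∸+≡ : ∀ {i} j → i < M → j + M ∸ i + i ≡ j + M
    ∸+≡ {i} j i<M = m∸n+n≡m (≤-trans (<⇒≤ i<M) (m≤n+m M j))

  ⊖-suc : ∀ j {t} → suc t < M → j ⊖ t ≋ j ⊖ suc t + 1
  ⊖-suc j {t} st<M = ≋-trans (%≋ (j + M ∸ t)) (≋-trans (≡⇒≋ step) (≋-+ʳ 1 (≋-sym (%≋ (j + M ∸ suc t)))))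
    where
    step : j + M ∸ t ≡ j + M ∸ suc t + 1
    step = begin
      j + M ∸ t                         ≡⟨ cong (_∸ t) (∸+≡ j st<M) ⟨
      j + M ∸ suc t + suc t ∸ t         ≡⟨ +-∸-assoc (j + M ∸ suc t) (n≤1+n t) ⟩
      j + M ∸ suc t + (suc t ∸ t)       ≡⟨ cong (j + M ∸ suc t +_) (m+n∸n≡m 1 t) ⟩
      j + M ∸ suc t + 1                 ∎

  [i+t]⊖i≡t : ∀ i t → i < M → t < M → (i + t) % M ⊖ i ≡ t
  [i+t]⊖i≡t i t i<M t<M = ≋⇒%≡ (≋-cancel+ʳ i (≋-trans (≡⇒≋ eq) (≋-trans (+kn≋ u 1) (≋-trans (%≋ (i + t)) (≡⇒≋ (+-comm i t)))))) t<M
    where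
    u = (i + t) % M
    eq : u + M ∸ i + i ≡ u + 1 * M
    eq = trans (∸+≡ u i<M) (cong (u +_) (sym (*-identityˡ M)))

  [i+[j⊖i]]%M≡j : ∀ i j → i < M → j < M → (i + (j ⊖ i)) % M ≡ j
  [i+[j⊖i]]%M≡j i j i<M j<M = ≋⇒%≡ (≋-trans (≋-+ˡ i (%≋ (j + M ∸ i))) (≋-trans (≡⇒≋ eq) (+kn≋ j 1))) j<M
    where
    eq : i + (j + M ∸ i) ≡ j + 1 * M
    eq = trans (+-comm i _) (trans (∸+≡ j i<M) (cong (j +_) (sym (*-identityˡ M))))

  j⊖[j⊖i]≡i : ∀ i j → i < M → j ⊖ (j ⊖ i) ≡ i
  j⊖[j⊖i]≡i i j i<M = ≋⇒%≡ (≋-cancel+ʳ (j ⊖ i) (≋-trans (≡⇒≋ (∸+≡ j (⊖< j i)))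
                          (≋-sym (≋-trans (≋-+ˡ i (%≋ (j + M ∸ i))) (≡⇒≋ (trans (+-comm i _) (∸+≡ j i<M))))))) i<M

  sumTo-⊖ʳ : ∀ i (g : ℕ → ℕ) → i < M → sumTo M (λ j → g (j ⊖ i)) ≡ sumTo M g
  sumTo-⊖ʳ i g i<M = trans (sumTo-cong M (λ j _ → cong (λ z → g (z % M)) (+-∸-assoc j (<⇒≤ i<M))))
                           (sumTo-rotate M (M ∸ i) g)

  sumTo-⊖ˡ : ∀ j (g : ℕ → ℕ) → sumTo M (λ i → g (j ⊖ i)) ≡ sumTo M g
  sumTo-⊖ˡ j g = begin
    sumTo M (λ i → g (j ⊖ i))                     ≡⟨ sumTo-reverse M (λ i → g (j ⊖ i)) ⟨
    sumTo M (λ i → g ((j + M ∸ (M ∸ suc i)) % M)) ≡⟨ sumTo-cong M (λ i i<M → cong (λ z → g (z % M)) (unreverse i i<M)) ⟩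
    sumTo M (λ i → g ((i + suc j) % M))           ≡⟨ sumTo-rotate M (suc j) g ⟩
    sumTo M g                                     ∎
    where
    unreverse : ∀ i → i < M → j + M ∸ (M ∸ suc i) ≡ i + suc j
    unreverse i i<M = begin
      j + M ∸ (M ∸ suc i)     ≡⟨ +-∸-assoc j (m∸n≤m M (suc i)) ⟩
      j + (M ∸ (M ∸ suc i))   ≡⟨ cong (j +_) (m∸[m∸n]≡n i<M) ⟩
      j + suc i               ≡⟨ +-comm j (suc i) ⟩
      suc i + j               ≡⟨ +-suc i j ⟨
      i + suc j               ∎

-- Magic rectangles from balanced fillings of a cyclic band

Digits : Set
Digits = ℕ × ℕ × ℕ

InRange : ℕ → ℕ → ℕ → Digits → Set
InRange M A B (h , y , x) = h < M × y < A × x < B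

record LayerPermutation (M A B : ℕ) : Set where
  field
    σ σ⁻¹     : ℕ → Digits → Digits
    σ-range   : ∀ t {d} → InRange M A B d → InRange M A B (σ t d)
    σ⁻¹-range : ∀ t {d} → InRange M A B d → InRange M A B (σ⁻¹ t d)
    σ⁻¹∘σ     : ∀ t {d} → InRange M A B d → σ⁻¹ t (σ t d) ≡ d
    σ∘σ⁻¹     : ∀ t {d} → InRange M A B d → σ t (σ⁻¹ t d) ≡ d

module Band (A B M S : ℕ) .{{_ : NonZero A}} .{{_ : NonZero B}} .{{_ : NonZero M}} where
  open Cyclic M

  N : ℕ
  N = A * M * (B * S)

  encode : ℕ → Digits → ℕ
  encode t (h , y , x) = ((t * M + h) * A + y) * B + x

  layer : ℕ → ℕ
  layer v = v / B / A / M

  digits : ℕ → Digits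
  digits v = v / B / A % M , v / B % A , v % B

  digits-range : ∀ v → InRange M A B (digits v)
  digits-range v = m%n<n (v / B / A) M , m%n<n (v / B) A , m%n<n v B

  encode< : ∀ {t d} → t < S → InRange M A B d → encode t d < N
  encode< {t} {h , y , x} t<S (h<M , y<A , x<B) =
    subst (encode t (h , y , x) <_) (reorder S M A B)
      (q*d+r<k*d B x<B (q*d+r<k*d A y<A (q*d+r<k*d M h<M t<S)))
    where
    reorder : ∀ S M A B → S * M * A * B ≡ A * M * (B * S)
    reorder = solve-∀

  layer< : ∀ {v} → v < N → layer v < S
  layer< {v} v<N = m<n*o⇒m/o<n {v / B / A} {S} {M} (m<n*o⇒m/o<n {v / B} {S * M} {A}
                     (m<n*o⇒m/o<n {v} {S * M * A} {B} (subst (v <_) (reorder S M A B) v<N)))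
    where
    reorder : ∀ S M A B → A * M * (B * S) ≡ S * M * A * B
    reorder = solve-∀

  module _ (t : ℕ) {h y x : ℕ} (h<M : h < M) (y<A : y < A) (x<B : x < B) where
    private
      v = encode t (h , y , x)
      v/B≡ : v / B ≡ (t * M + h) * A + y
      v/B≡ = [q*d+r]/d≡q ((t * M + h) * A + y) x B x<B
      v/B/A≡ : v / B / A ≡ t * M + h
      v/B/A≡ = trans (cong (_/ A) v/B≡) ([q*d+r]/d≡q (t * M + h) y A y<A)

    layer-encode : layer (encode t (h , y , x)) ≡ t
    layer-encode = trans (cong (_/ M) v/B/A≡) ([q*d+r]/d≡q t h M h<M)

    digits-encode : digits (encode t (h , y , x)) ≡ (h , y , x)
    digits-encode = cong₂ _,_ (trans (cong (_% M) v/B/A≡) ([q*d+r]%d≡r t h M h<M))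
                     (cong₂ _,_ (trans (cong (_% A) v/B≡) ([q*d+r]%d≡r (t * M + h) y A y<A))
                                ([q*d+r]%d≡r ((t * M + h) * A + y) x B x<B))

  encode-decode : ∀ v → encode (layer v) (digits v) ≡ v
  encode-decode v = begin
    ((v / B / A / M * M + v / B / A % M) * A + v / B % A) * B + v % B
      ≡⟨ cong (λ z → (z * A + v / B % A) * B + v % B) ([m/d]*d+m%d≡m (v / B / A) M) ⟩
    (v / B / A * A + v / B % A) * B + v % B
      ≡⟨ cong (λ z → z * B + v % B) ([m/d]*d+m%d≡m (v / B) A) ⟩
    v / B * B + v % B
      ≡⟨ [m/d]*d+m%d≡m v B ⟩
    v ∎

  module _ (L : LayerPermutation M A B) where
    open LayerPermutation L

    entry : ℕ → Digits → ℕ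
    entry t d = encode t (σ t d)

    entry< : ∀ {t d} → t < S → InRange M A B d → entry t d < N
    entry< {t} t<S d∈ = encode< t<S (σ-range t d∈)

    entry-injective : ∀ {t d t′ d′} → InRange M A B d → InRange M A B d′ →
                      entry t d ≡ entry t′ d′ → t ≡ t′ × d ≡ d′
    entry-injective {t} {d} {t′} {d′} d∈ d′∈ eq with σ t d in σd | σ-range t d∈
    ... | h , y , x | h<M , y<A , x<B with σ t′ d′ in σd′ | σ-range t′ d′∈
    ...   | h′ , y′ , x′ | h′<M , y′<A , x′<B = t≡t′ , d≡d′
      where
      t≡t′ : t ≡ t′
      t≡t′ = trans (sym (layer-encode t h<M y<A x<B)) (trans (cong layer eq) (layer-encode t′ h′<M y′<A x′<B))
      σ≡ : σ t d ≡ σ t d′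
      σ≡ = begin
        σ t d                             ≡⟨ σd ⟩
        h , y , x                         ≡⟨ digits-encode t h<M y<A x<B ⟨
        digits (encode t (h , y , x))     ≡⟨ cong digits eq ⟩
        digits (encode t′ (h′ , y′ , x′)) ≡⟨ digits-encode t′ h′<M y′<A x′<B ⟩
        h′ , y′ , x′                      ≡⟨ σd′ ⟨
        σ t′ d′                           ≡⟨ cong (λ s → σ s d′) t≡t′ ⟨
        σ t d′                            ∎
      d≡d′ : d ≡ d′
      d≡d′ = trans (sym (σ⁻¹∘σ t d∈)) (trans (cong (σ⁻¹ t) σ≡) (σ⁻¹∘σ t d′∈))

    entry-surjective : ∀ v → ∃[ d ] (InRange M A B d × entry (layer v) d ≡ v)
    entry-surjective v = σ⁻¹ t (digits v) , σ⁻¹-range t (digits-range v) , (begin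
      encode t (σ t (σ⁻¹ t (digits v))) ≡⟨ cong (encode t) (σ∘σ⁻¹ t (digits-range v)) ⟩
      encode t (digits v)               ≡⟨ encode-decode v ⟩
      v                                 ∎)
      where t = layer v

  high low : Digits → ℕ
  high (h , _ , _) = h
  low  (_ , y , x) = y * B + x

  encode≡ : ∀ t d → encode t d ≡ t * (M * A * B) + high d * (A * B) + low d
  encode≡ t (h , y , x) = expand t M A B h y x
    where
    expand : ∀ t M A B h y x → ((t * M + h) * A + y) * B + x ≡ t * (M * A * B) + h * (A * B) + (y * B + x)
    expand = solve-∀

  sumTo-encode : ∀ k (d : ℕ → ℕ → Digits) →
    sumTo S (λ t → sumTo k (λ j → encode t (d t j)))
      ≡ k * (sumTo S (λ t → t) * (M * A * B))
        + sumTo S (λ t → sumTo k (λ j → high (d t j))) * (A * B)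
        + sumTo S (λ t → sumTo k (λ j → low (d t j)))
  sumTo-encode k d = begin
    sumTo S (λ t → sumTo k (λ j → encode t (d t j)))
      ≡⟨ sumTo-cong S (λ t _ → layer-sum t) ⟩
    sumTo S (λ t → k * (t * (M * A * B)) + Σhigh t * (A * B) + Σlow t)
      ≡⟨ sumTo-+₃ S _ _ Σlow ⟩
    sumTo S (λ t → k * (t * (M * A * B))) + sumTo S (λ t → Σhigh t * (A * B)) + sumTo S Σlow
      ≡⟨ cong₂ (λ a b → a + b + sumTo S Σlow)
               (trans (sumTo-*ˡ S k _) (cong (k *_) (sumTo-*ʳ S (λ t → t) _))) (sumTo-*ʳ S Σhigh _) ⟩
    k * (sumTo S (λ t → t) * (M * A * B)) + sumTo S Σhigh * (A * B) + sumTo S Σlow ∎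
    where
    Σhigh Σlow : ℕ → ℕ
    Σhigh t = sumTo k (λ j → high (d t j))
    Σlow  t = sumTo k (λ j → low (d t j))
    layer-sum : ∀ t → sumTo k (λ j → encode t (d t j)) ≡ k * (t * (M * A * B)) + Σhigh t * (A * B) + Σlow t
    layer-sum t = begin
      sumTo k (λ j → encode t (d t j))
        ≡⟨ sumTo-cong k (λ j _ → encode≡ t (d t j)) ⟩
      sumTo k (λ j → t * (M * A * B) + high (d t j) * (A * B) + low (d t j))
        ≡⟨ sumTo-+₃ k _ _ _ ⟩
      sumTo k (λ _ → t * (M * A * B)) + sumTo k (λ j → high (d t j) * (A * B)) + Σlow t
        ≡⟨ cong₂ (λ a b → a + b + Σlow t) (sumTo-const k _) (sumTo-*ʳ k (λ j → high (d t j)) _) ⟩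
      k * (t * (M * A * B)) + Σhigh t * (A * B) + Σlow t ∎

  record BalancedFilling : Set where
    field
      layers        : LayerPermutation M A B
      rowSum colSum : ℕ
      row-sum : ∀ {i1 i2} → i1 < M → i2 < A →
                sumTo S (λ t → sumTo B (λ j2 → entry layers t (i1 , i2 , j2))) ≡ rowSum
      col-sum : ∀ {j1 j2} → j1 < M → j2 < B →
                sumTo S (λ t → sumTo A (λ i2 → entry layers t (j1 ⊖ t , i2 , j2))) ≡ colSum

  offset : ℕ → ℕ → ℕ
  offset R C = C % M ⊖ R % M

  onBand : (ℕ → Digits → ℕ) → ℕ → ℕ → ℕ
  onBand g R C = if offset R C <ᵇ S then g (offset R C) (R % M , R / M , C / M) else 0

  module _ (S≤M : S ≤ M) where

    onBand-row : ∀ g R → sumTo (B * M) (onBand g R) ≡ sumTo B (λ j2 → sumTo S (λ t → g t (R % M , R / M , j2)))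
    onBand-row g R = begin
      sumTo (B * M) (onBand g R)                            ≡⟨ sumTo-blocks B M (onBand g R) ⟩
      sumTo B (λ j2 → sumTo M (λ j1 → onBand g R (j2 * M + j1))) ≡⟨ sumTo-cong B (λ j2 _ → block j2) ⟩
      sumTo B (λ j2 → sumTo S (λ t → g t (i1 , i2 , j2)))   ∎
      where
      i1 = R % M
      i2 = R / M
      block : ∀ j2 → sumTo M (λ j1 → onBand g R (j2 * M + j1)) ≡ sumTo S (λ t → g t (i1 , i2 , j2))
      block j2 = begin
        sumTo M (λ j1 → onBand g R (j2 * M + j1))
          ≡⟨ sumTo-cong M (λ j1 j1<M → cong₂ (λ a b → if a ⊖ i1 <ᵇ S then g (a ⊖ i1) (i1 , i2 , b) else 0)
                                             ([q*d+r]%d≡r j2 j1 M j1<M) ([q*d+r]/d≡q j2 j1 M j1<M)) ⟩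
        sumTo M (λ j1 → G (j1 ⊖ i1)) ≡⟨ sumTo-⊖ʳ i1 G (m%n<n R M) ⟩
        sumTo M G                     ≡⟨ sumTo-truncate S M (λ t → g t (i1 , i2 , j2)) S≤M ⟩
        sumTo S (λ t → g t (i1 , i2 , j2)) ∎
        where
        G : ℕ → ℕ
        G t = if t <ᵇ S then g t (i1 , i2 , j2) else 0

    onBand-col : ∀ g C → sumTo (A * M) (λ R → onBand g R C) ≡ sumTo A (λ i2 → sumTo S (λ t → g t (C % M ⊖ t , i2 , C / M)))
    onBand-col g C = begin
      sumTo (A * M) (λ R → onBand g R C)                          ≡⟨ sumTo-blocks A M (λ R → onBand g R C) ⟩
      sumTo A (λ i2 → sumTo M (λ i1 → onBand g (i2 * M + i1) C))  ≡⟨ sumTo-cong A (λ i2 _ → block i2) ⟩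
      sumTo A (λ i2 → sumTo S (λ t → g t (j1 ⊖ t , i2 , j2)))     ∎
      where
      j1 = C % M
      j2 = C / M
      block : ∀ i2 → sumTo M (λ i1 → onBand g (i2 * M + i1) C) ≡ sumTo S (λ t → g t (j1 ⊖ t , i2 , j2))
      block i2 = begin
        sumTo M (λ i1 → onBand g (i2 * M + i1) C) ≡⟨ sumTo-cong M (λ i1 i1<M → cell≡ i1 i1<M) ⟩
        sumTo M (λ i1 → G (j1 ⊖ i1))               ≡⟨ sumTo-⊖ˡ j1 G ⟩
        sumTo M G                                  ≡⟨ sumTo-truncate S M (λ t → g t (j1 ⊖ t , i2 , j2)) S≤M ⟩
        sumTo S (λ t → g t (j1 ⊖ t , i2 , j2))     ∎
        where
        G : ℕ → ℕ
        G t = if t <ᵇ S then g t (j1 ⊖ t , i2 , j2) else 0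
        cell≡ : ∀ i1 → i1 < M → onBand g (i2 * M + i1) C ≡ G (j1 ⊖ i1)
        cell≡ i1 i1<M = begin
          onBand g (i2 * M + i1) C
            ≡⟨ cong₂ (λ a b → if j1 ⊖ a <ᵇ S then g (j1 ⊖ a) (a , b , j2) else 0)
                     ([q*d+r]%d≡r i2 i1 M i1<M) ([q*d+r]/d≡q i2 i1 M i1<M) ⟩
          (if j1 ⊖ i1 <ᵇ S then g (j1 ⊖ i1) (i1 , i2 , j2) else 0)
            ≡⟨ cong (λ a → if j1 ⊖ i1 <ᵇ S then g (j1 ⊖ i1) (a , i2 , j2) else 0) (j⊖[j⊖i]≡i i1 j1 i1<M) ⟨
          G (j1 ⊖ i1) ∎

  module Construction (S≤M : S ≤ M) (F : BalancedFilling) where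
    open BalancedFilling F
    open LayerPermutation layers using (σ)

    coords : ∀ {R C} → R < A * M → C < B * M → InRange M A B (R % M , R / M , C / M)
    coords {R} {C} R<AM C<BM = m%n<n R M , m<n*o⇒m/o<n R<AM , m<n*o⇒m/o<n C<BM

    cell : (R C : ℕ) → R < A * M → C < B * M → Maybe (Fin N)
    cell R C R<AM C<BM with offset R C <? S
    ... | yes t<S = just (fromℕ< (entry< layers t<S (coords R<AM C<BM)))
    ... | no  _   = nothing

    array : Array (A * M) (B * M) (A * M * (B * S))
    array r c = cell (toℕ r) (toℕ c) (toℕ<n r) (toℕ<n c)

    val-cell : ∀ R C p q → val (cell R C p q) ≡ onBand (entry layers) R C
    val-cell R C p q with offset R C <? S
    ... | yes t<S = trans (toℕ-fromℕ< _) (sym (cong (λ b → if b then value else 0) (<ᵇ-true t<S)))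
      where value = entry layers (offset R C) (R % M , R / M , C / M)
    ... | no  t≮S = sym (cong (λ b → if b then value else 0) (<ᵇ-false t≮S))
      where value = entry layers (offset R C) (R % M , R / M , C / M)

    filled-cell : ∀ R C p q → filled (cell R C p q) ≡ onBand (λ _ _ → 1) R C
    filled-cell R C p q with offset R C <? S
    ... | yes t<S = sym (cong (λ b → if b then 1 else 0) (<ᵇ-true t<S))
    ... | no  t≮S = sym (cong (λ b → if b then 1 else 0) (<ᵇ-false t≮S))

    cell-just : ∀ R C p q → offset R C < S →
                ∃[ y ] (cell R C p q ≡ just y × toℕ y ≡ entry layers (offset R C) (R % M , R / M , C / M))
    cell-just R C p q t<S with offset R C <? S
    ... | yes _   = _ , refl , toℕ-fromℕ< _
    ... | no  t≮S = ⊥-elim (t≮S t<S)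

    cell-inv : ∀ R C p q (y : Fin N) → cell R C p q ≡ just y →
               toℕ y ≡ entry layers (offset R C) (R % M , R / M , C / M)
    cell-inv R C p q y eq with offset R C <? S
    cell-inv R C p q y refl | yes _ = toℕ-fromℕ< _
    cell-inv R C p q y ()   | no  _

    ∑-row : ∀ (g : ℕ → Digits → ℕ) (r : Fin (A * M)) {h : Fin (B * M) → ℕ} →
            (∀ c → h c ≡ onBand g (toℕ r) (toℕ c)) →
            ∑ (B * M) h ≡ sumTo S (λ t → sumTo B (λ j2 → g t (toℕ r % M , toℕ r / M , j2)))
    ∑-row g r {h} h≡ = begin
      ∑ (B * M) h                                          ≡⟨ ∑-cong (B * M) h≡ ⟩
      ∑ (B * M) (λ c → onBand g R (toℕ c))                 ≡⟨ ∑≡sumTo (B * M) (onBand g R) ⟩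
      sumTo (B * M) (onBand g R)                           ≡⟨ onBand-row S≤M g R ⟩
      sumTo B (λ j2 → sumTo S (λ t → g t (R % M , R / M , j2))) ≡⟨ sumTo-swap B S _ ⟩
      sumTo S (λ t → sumTo B (λ j2 → g t (R % M , R / M , j2))) ∎
      where R = toℕ r

    ∑-col : ∀ (g : ℕ → Digits → ℕ) (c : Fin (B * M)) {h : Fin (A * M) → ℕ} →
            (∀ r → h r ≡ onBand g (toℕ r) (toℕ c)) →
            ∑ (A * M) h ≡ sumTo S (λ t → sumTo A (λ i2 → g t (toℕ c % M ⊖ t , i2 , toℕ c / M)))
    ∑-col g c {h} h≡ = begin
      ∑ (A * M) h                                        ≡⟨ ∑-cong (A * M) h≡ ⟩
      ∑ (A * M) (λ r → onBand g (toℕ r) C)               ≡⟨ ∑≡sumTo (A * M) (λ R → onBand g R C) ⟩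
      sumTo (A * M) (λ R → onBand g R C)                 ≡⟨ onBand-col S≤M g C ⟩
      sumTo A (λ i2 → sumTo S (λ t → g t (C % M ⊖ t , i2 , C / M))) ≡⟨ sumTo-swap A S _ ⟩
      sumTo S (λ t → sumTo A (λ i2 → g t (C % M ⊖ t , i2 , C / M))) ∎
      where C = toℕ c

    sumTo-ones : ∀ k → sumTo S (λ _ → sumTo k (λ _ → 1)) ≡ k * S
    sumTo-ones k = begin
      sumTo S (λ _ → sumTo k (λ _ → 1)) ≡⟨ sumTo-cong S (λ _ _ → trans (sumTo-const k 1) (*-identityʳ k)) ⟩
      sumTo S (λ _ → k)                 ≡⟨ sumTo-const S k ⟩
      S * k                             ≡⟨ *-comm S k ⟩
      k * S                             ∎

    occurs : ∀ (x : Fin N) → ∃[ r ] ∃[ c ] (array r c ≡ just x)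
    occurs x with entry-surjective layers (toℕ x)
    ... | (i1 , i2 , j2) , (i1<M , i2<A , j2<B) , entry≡x = fromℕ< R<AM , fromℕ< C<BM , at-R,C
      where
      t = layer (toℕ x)
      t<S : t < S
      t<S = layer< (toℕ<n x)
      j1 = (i1 + t) % M
      R = i2 * M + i1
      C = j2 * M + j1
      R<AM : R < A * M
      R<AM = q*d+r<k*d M i1<M i2<A
      C<BM : C < B * M
      C<BM = q*d+r<k*d M (m%n<n (i1 + t) M) j2<B
      R%M≡ = [q*d+r]%d≡r i2 i1 M i1<M
      C%M≡ = [q*d+r]%d≡r j2 j1 M (m%n<n (i1 + t) M)
      offset≡t : offset R C ≡ t
      offset≡t = trans (cong₂ _⊖_ C%M≡ R%M≡) ([i+t]⊖i≡t i1 t i1<M (≤-trans t<S S≤M))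
      coords≡ : (R % M , R / M , C / M) ≡ (i1 , i2 , j2)
      coords≡ = cong₂ _,_ R%M≡ (cong₂ _,_ ([q*d+r]/d≡q i2 i1 M i1<M) ([q*d+r]/d≡q j2 j1 M (m%n<n (i1 + t) M)))
      cell≡ : ∀ {R′ C′} p q → R′ ≡ R → C′ ≡ C → cell R′ C′ p q ≡ just x
      cell≡ p q refl refl with cell-just R C p q (subst (_< S) (sym offset≡t) t<S)
      ... | y , cell≡y , y≡ = trans cell≡y (cong just (toℕ-injective (begin
        toℕ y                                               ≡⟨ y≡ ⟩
        entry layers (offset R C) (R % M , R / M , C / M)   ≡⟨ cong₂ (entry layers) offset≡t coords≡ ⟩
        entry layers t (i1 , i2 , j2)                       ≡⟨ entry≡x ⟩
        toℕ x                                               ∎)))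
      at-R,C : array (fromℕ< R<AM) (fromℕ< C<BM) ≡ just x
      at-R,C = cell≡ _ _ (toℕ-fromℕ< R<AM) (toℕ-fromℕ< C<BM)

    once : ∀ r c r′ c′ (x : Fin N) → array r c ≡ just x → array r′ c′ ≡ just x → r ≡ r′ × c ≡ c′
    once r c r′ c′ x at-r,c at-r′,c′ = toℕ-injective R≡R′ , toℕ-injective C≡C′
      where
      R = toℕ r
      C = toℕ c
      R′ = toℕ r′
      C′ = toℕ c′
      same-entry = entry-injective layers (coords (toℕ<n r) (toℕ<n c)) (coords (toℕ<n r′) (toℕ<n c′))
                     (trans (sym (cell-inv R C _ _ x at-r,c)) (cell-inv R′ C′ _ _ x at-r′,c′))
      offset≡ : offset R C ≡ offset R′ C′
      offset≡ = proj₁ same-entry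
      R%M≡ : R % M ≡ R′ % M
      R%M≡ = cong proj₁ (proj₂ same-entry)
      R/M≡ : R / M ≡ R′ / M
      R/M≡ = cong (λ d → proj₁ (proj₂ d)) (proj₂ same-entry)
      C/M≡ : C / M ≡ C′ / M
      C/M≡ = cong (λ d → proj₂ (proj₂ d)) (proj₂ same-entry)
      C%M≡ : C % M ≡ C′ % M
      C%M≡ = begin
        C % M                       ≡⟨ [i+[j⊖i]]%M≡j (R % M) (C % M) (m%n<n R M) (m%n<n C M) ⟨
        (R % M + offset R C) % M    ≡⟨ cong₂ (λ a b → (a + b) % M) R%M≡ offset≡ ⟩
        (R′ % M + offset R′ C′) % M ≡⟨ [i+[j⊖i]]%M≡j (R′ % M) (C′ % M) (m%n<n R′ M) (m%n<n C′ M) ⟩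
        C′ % M                      ∎
      recombine : ∀ {X Y} → X % M ≡ Y % M → X / M ≡ Y / M → X ≡ Y
      recombine {X} {Y} %≡ /≡ = trans (m≡m%n+[m/n]*n X M) (trans (cong₂ (λ a b → a + b * M) %≡ /≡) (sym (m≡m%n+[m/n]*n Y M)))
      R≡R′ : R ≡ R′
      R≡R′ = recombine R%M≡ R/M≡
      C≡C′ : C ≡ C′
      C≡C′ = recombine C%M≡ C/M≡

    magicRectangle : MagicRectangle (A * M) (B * M) (B * S) (A * S)
    magicRectangle = array , record
      { rowCount = λ r → trans (∑-row (λ _ _ → 1) r (λ c → filled-cell _ _ _ _)) (sumTo-ones B)
      ; colCount = λ c → trans (∑-col (λ _ _ → 1) c (λ r → filled-cell _ _ _ _)) (sumTo-ones A)
      ; occurs   = occurs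
      ; once     = once
      ; rowSum   = λ r r′ → trans (row r) (sym (row r′))
      ; colSum   = λ c c′ → trans (col c) (sym (col c′))
      }
      where
      row : ∀ r → ∑ (B * M) (λ c → val (array r c)) ≡ rowSum
      row r = trans (∑-row (entry layers) r (λ c → val-cell _ _ _ _))
                    (row-sum (m%n<n (toℕ r) M) (m<n*o⇒m/o<n (toℕ<n r)))
      col : ∀ c → ∑ (A * M) (λ r → val (array r c)) ≡ colSum
      col c = trans (∑-col (entry layers) c (λ r → val-cell _ _ _ _))
                    (col-sum (m%n<n (toℕ c) M) (m<n*o⇒m/o<n (toℕ<n c)))

-- Odd layers: affine Kotzig arrays over ℤ/(2h+1)

module ResidueSums (h : ℕ) where
  n : ℕ
  n = suc (h + h)
  open Modulo n public

  ≡kn⇒≋0 : ∀ {x} k → x ≡ k * n → x ≋ 0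
  ≡kn⇒≋0 k eq = ≋-trans (≡⇒≋ eq) (kn≋0 k)

  pair-residues : ∀ x y → x + y + 1 ≋ 0 → x % n + y % n ≡ h + h
  pair-residues x y p = suc-injective (trans (+-comm 1 (x % n + y % n)) (residues-sum-to-n∸1 x y p))

  W+2u+1≋0 : ∀ U W → W + (U + U) + 1 ≋ 0 → W + (U % n + U % n + 1) ≋ 0
  W+2u+1≋0 U W W≋ = ≋-trans (≋-+ˡ W (≋-+ʳ 1 (≋-+ (%≋ U) (%≋ U)))) (≋-trans (≡⇒≋ (sym (+-assoc W (U + U) 1))) W≋)

  triple-residues-low : ∀ U V W → U % n ≤ h → V ≋ U + h → W + (U + U) + 1 ≋ 0 → U % n + V % n + W % n ≡ h + h + h
  triple-residues-low U V W u≤h V≋ W≋ = begin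
    u + V % n + W % n       ≡⟨ cong₂ (λ a b → u + a + b) V%n≡ W%n≡ ⟩
    u + (u + h) + (k + k)   ≡⟨ cong (λ z → u + (u + z) + (k + k)) (sym u+k≡h) ⟩
    u + (u + (u + k)) + (k + k) ≡⟨ regroup u k ⟩
    (u + k) + (u + k) + (u + k) ≡⟨ cong (λ z → z + z + z) u+k≡h ⟩
    h + h + h               ∎
    where
    u = U % n
    k = proj₁ (m≤n⇒∃[o]m+o≡n u≤h)
    u+k≡h : u + k ≡ h
    u+k≡h = proj₂ (m≤n⇒∃[o]m+o≡n u≤h)
    V%n≡ : V % n ≡ u + h
    V%n≡ = ≋⇒%≡ (≋-trans V≋ (≋-+ʳ h (≋-sym (%≋ U)))) (s≤s (+-monoˡ-≤ h u≤h))
    2k+2u+1≡n : k + k + (u + u + 1) ≡ n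
    2k+2u+1≡n = trans (rearrange u k) (cong (λ z → suc (z + z)) u+k≡h)
      where
      rearrange : ∀ u k → k + k + (u + u + 1) ≡ suc ((u + k) + (u + k))
      rearrange = solve-∀
    W%n≡ : W % n ≡ k + k
    W%n≡ = ≋⇒%≡ (≋-cancel+ʳ {W} (u + u + 1) (≋-trans (W+2u+1≋0 U W W≋) (≋-sym (≋-trans (≡⇒≋ 2k+2u+1≡n) n≋0)))) 2k<n
      where
      k≤h = subst (k ≤_) u+k≡h (m≤n+m k u)
      2k<n = s≤s (+-mono-≤ k≤h k≤h)
    regroup : ∀ u k → u + (u + (u + k)) + (k + k) ≡ (u + k) + (u + k) + (u + k)
    regroup = solve-∀

  triple-residues-high : ∀ U V W → h < U % n → V ≋ U + h → W + (U + U) + 1 ≋ 0 → U % n + V % n + W % n ≡ h + h + h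
  triple-residues-high U V W h<u V≋ W≋ = begin
    u + V % n + W % n                     ≡⟨ cong₂ (λ a b → u + a + b) V%n≡ W%n≡ ⟩
    u + e + (k + k + 1)                   ≡⟨ cong (λ z → z + e + (k + k + 1)) (sym h+1+e≡u) ⟩
    suc h + e + e + (k + k + 1)           ≡⟨ cong (λ z → suc z + e + e + (k + k + 1)) (sym e+1+k≡h) ⟩
    suc (suc e + k) + e + e + (k + k + 1) ≡⟨ regroup e k ⟩
    (suc e + k) + (suc e + k) + (suc e + k) ≡⟨ cong (λ z → z + z + z) e+1+k≡h ⟩
    h + h + h                             ∎
    where
    u = U % n
    u<n = m%n<n U n
    e = proj₁ (m≤n⇒∃[o]m+o≡n h<u)
    h+1+e≡u : suc h + e ≡ u
    h+1+e≡u = proj₂ (m≤n⇒∃[o]m+o≡n h<u)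
    e<h : e < h
    e<h = +-cancelˡ-< (suc h) e h (subst (λ z → suc z ≤ suc h + h) (sym h+1+e≡u) u<n)
    k = proj₁ (m≤n⇒∃[o]m+o≡n e<h)
    e+1+k≡h : suc e + k ≡ h
    e+1+k≡h = proj₂ (m≤n⇒∃[o]m+o≡n e<h)
    V%n≡ : V % n ≡ e
    V%n≡ = ≋⇒%≡ (≋-trans V≋ (≋-trans (≋-+ʳ h (≋-sym (%≋ U)))
                   (≋-trans (≡⇒≋ (trans (cong (_+ h) (sym h+1+e≡u)) (wrap e h))) (+kn≋ e 1))))
                (≤-trans e<h (≤-trans (m≤m+n h h) (n≤1+n (h + h))))
      where
      wrap : ∀ e h → suc h + e + h ≡ e + 1 * suc (h + h)
      wrap = solve-∀
    2k+1+2u+1≡2n : (k + k + 1) + (u + u + 1) ≡ 2 * n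
    2k+1+2u+1≡2n = begin
      (k + k + 1) + (u + u + 1)                         ≡⟨ cong (λ z → (k + k + 1) + (z + z + 1)) (sym h+1+e≡u) ⟩
      (k + k + 1) + ((suc h + e) + (suc h + e) + 1)     ≡⟨ cong (λ z → (k + k + 1) + ((suc z + e) + (suc z + e) + 1)) (sym e+1+k≡h) ⟩
      (k + k + 1) + ((suc (suc e + k) + e) + (suc (suc e + k) + e) + 1) ≡⟨ rearrange e k ⟩
      2 * suc ((suc e + k) + (suc e + k))               ≡⟨ cong (λ z → 2 * suc (z + z)) e+1+k≡h ⟩
      2 * n                                             ∎
      where
      rearrange : ∀ e k → (k + k + 1) + ((suc (suc e + k) + e) + (suc (suc e + k) + e) + 1) ≡ 2 * suc ((suc e + k) + (suc e + k))
      rearrange = solve-∀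
    W%n≡ : W % n ≡ k + k + 1
    W%n≡ = ≋⇒%≡ (≋-cancel+ʳ {W} (u + u + 1) (≋-trans (W+2u+1≋0 U W W≋) (≋-sym (≋-trans (≡⇒≋ 2k+1+2u+1≡2n) (kn≋0 2))))) 2k+1<n
      where
      k<h = subst (k <_) e+1+k≡h (s≤s (m≤n+m k e))
      2k+1<n = s≤s (subst (_≤ h + h) (+-comm 1 (k + k)) (+-mono-≤ k<h (<⇒≤ k<h)))
    regroup : ∀ e k → suc (suc e + k) + e + e + (k + k + 1) ≡ (suc e + k) + (suc e + k) + (suc e + k)
    regroup = solve-∀

  triple-residues : ∀ U V W → V ≋ U + h → W + (U + U) + 1 ≋ 0 → U % n + V % n + W % n ≡ h + h + h
  triple-residues U V W with U % n ≤? h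
  ... | yes u≤h = triple-residues-low U V W u≤h
  ... | no  u≰h = triple-residues-high U V W (≰⇒> u≰h)

module AffineKotzig (g : ℕ) where
  h : ℕ
  h = suc g
  open ResidueSums h public

  minus-one minus-two : ℕ
  minus-one = h + h
  minus-two = suc (g + g)

  record AffineMap : Set where
    constructor affine
    field slope slope⁻¹ shift : ℕ

  ⟦_⟧ : AffineMap → ℕ → ℕ
  ⟦ affine α _ β ⟧ x = (α * x + β) % n

  inverse : AffineMap → AffineMap
  inverse (affine α α⁻¹ β) = affine α⁻¹ α (minus-one * α⁻¹ * β)

  Invertible : AffineMap → Set
  Invertible (affine α α⁻¹ _) = α⁻¹ * α ≋ 1

  ⟦⟧< : ∀ f x → ⟦ f ⟧ x < n
  ⟦⟧< (affine α _ β) x = m%n<n (α * x + β) n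

  inverse-⟦⟧ : ∀ f → Invertible f → ∀ {x} → x < n → ⟦ inverse f ⟧ (⟦ f ⟧ x) ≡ x
  inverse-⟦⟧ (affine α α⁻¹ β) α⁻¹α≋1 {x} x<n = ≋⇒%≡ (begin≋) x<n
    where
    expand : ∀ α α⁻¹ β x g → α⁻¹ * (α * x + β) + (suc g + suc g) * α⁻¹ * β
                           ≡ x * (α⁻¹ * α) + α⁻¹ * β * suc (suc g + suc g)
    expand = solve-∀
    begin≋ : α⁻¹ * ((α * x + β) % n) + minus-one * α⁻¹ * β ≋ x
    begin≋ = ≋-trans (≋-+ʳ (minus-one * α⁻¹ * β) (≋-*ˡ α⁻¹ (%≋ (α * x + β))))
             (≋-trans (≡⇒≋ (expand α α⁻¹ β x g))
             (≋-trans (≋-+ (≋-*ˡ x α⁻¹α≋1) (≋-refl {α⁻¹ * β * n}))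
             (≋-trans (≡⇒≋ (cong (_+ α⁻¹ * β * n) (*-identityʳ x))) (+kn≋ x (α⁻¹ * β)))))

  ⟦⟧-inverse : ∀ f → Invertible f → ∀ {y} → y < n → ⟦ f ⟧ (⟦ inverse f ⟧ y) ≡ y
  ⟦⟧-inverse (affine α α⁻¹ β) α⁻¹α≋1 {y} y<n = ≋⇒%≡ (begin≋) y<n
    where
    expand : ∀ α α⁻¹ β y g → α * (α⁻¹ * y + (suc g + suc g) * α⁻¹ * β) + β
                           ≡ y * (α⁻¹ * α) + ((α⁻¹ * α) * ((suc g + suc g) * β) + β)
    expand = solve-∀
    collapse : ∀ y β g → y * 1 + (1 * ((suc g + suc g) * β) + β) ≡ y + β * suc (suc g + suc g)
    collapse = solve-∀
    begin≋ : α * ((α⁻¹ * y + minus-one * α⁻¹ * β) % n) + β ≋ y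
    begin≋ = ≋-trans (≋-+ʳ β (≋-*ˡ α (%≋ (α⁻¹ * y + minus-one * α⁻¹ * β))))
             (≋-trans (≡⇒≋ (expand α α⁻¹ β y g))
             (≋-trans (≋-+ (≋-*ˡ y α⁻¹α≋1) (≋-+ (≋-* α⁻¹α≋1 (≋-refl {minus-one * β})) (≋-refl {β})))
             (≋-trans (≡⇒≋ (collapse y β g)) (+kn≋ y β))))

  -- Rows of S × n Kotzig arrays for S = 3, 4, 5, whose sums are constant along columns and along
  -- descending diagonals; larger S stack blocks of 4 and 3 rows.
  T3 T4 T5 : ℕ → AffineMap
  T3 0 = affine h minus-two 0
  T3 1 = affine 1 1 minus-one
  T3 2 = affine h minus-two h
  T3 _ = affine 1 1 0
  T4 0 = affine 1 1 0
  T4 1 = affine minus-one minus-one minus-two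
  T4 2 = affine minus-one minus-one minus-one
  T4 3 = affine 1 1 1
  T4 _ = affine 1 1 0
  T5 0 = affine 1 1 0
  T5 1 = affine h minus-two g
  T5 2 = affine minus-one minus-one minus-one
  T5 3 = affine h minus-two minus-two
  T5 4 = affine 1 1 2
  T5 _ = affine 1 1 0

  coef : ℕ → ℕ → AffineMap
  coef 3 t = T3 t
  coef 4 t = T4 t
  coef 5 t = T5 t
  coef 6 (suc (suc (suc t))) = T3 t
  coef 6 t = T3 t
  coef (suc (suc (suc (suc (suc (suc (suc S))))))) (suc (suc (suc (suc t)))) = coef (suc (suc (suc S))) t
  coef (suc (suc (suc (suc (suc (suc (suc S))))))) t = T4 t
  coef _ _ = affine 1 1 0

  kotzig kotzig⁻¹ : ℕ → ℕ → ℕ → ℕ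
  kotzig   S t = ⟦ coef S t ⟧
  kotzig⁻¹ S t = ⟦ inverse (coef S t) ⟧

  h-invertible : minus-two * h ≋ 1
  h-invertible = ≋-trans (≡⇒≋ (expand g)) (+kn≋ 1 g)
    where
    expand : ∀ g → suc (g + g) * suc g ≡ 1 + g * suc (suc g + suc g)
    expand = solve-∀

  minus-one-invertible : minus-one * minus-one ≋ 1
  minus-one-invertible = ≋-trans (≡⇒≋ (expand g)) (+kn≋ 1 (suc (g + g)))
    where
    expand : ∀ g → (suc g + suc g) * (suc g + suc g) ≡ 1 + suc (g + g) * suc (suc g + suc g)
    expand = solve-∀

  T3-invertible : ∀ t → Invertible (T3 t)
  T3-invertible 0 = h-invertible
  T3-invertible 1 = ≋-refl
  T3-invertible 2 = h-invertible
  T3-invertible (suc (suc (suc _))) = ≋-refl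

  T4-invertible : ∀ t → Invertible (T4 t)
  T4-invertible 0 = ≋-refl
  T4-invertible 1 = minus-one-invertible
  T4-invertible 2 = minus-one-invertible
  T4-invertible 3 = ≋-refl
  T4-invertible (suc (suc (suc (suc _)))) = ≋-refl

  T5-invertible : ∀ t → Invertible (T5 t)
  T5-invertible 0 = ≋-refl
  T5-invertible 1 = h-invertible
  T5-invertible 2 = minus-one-invertible
  T5-invertible 3 = h-invertible
  T5-invertible 4 = ≋-refl
  T5-invertible (suc (suc (suc (suc (suc _))))) = ≋-refl

  coef-invertible : ∀ S t → Invertible (coef S t)
  coef-invertible 0 t = ≋-refl
  coef-invertible 1 t = ≋-refl
  coef-invertible 2 t = ≋-refl
  coef-invertible 3 t = T3-invertible t
  coef-invertible 4 t = T4-invertible t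
  coef-invertible 5 t = T5-invertible t
  coef-invertible 6 (suc (suc (suc t))) = T3-invertible t
  coef-invertible 6 0 = T3-invertible 0
  coef-invertible 6 1 = T3-invertible 1
  coef-invertible 6 2 = T3-invertible 2
  coef-invertible (suc (suc (suc (suc (suc (suc (suc S))))))) (suc (suc (suc (suc t)))) = coef-invertible (suc (suc (suc S))) t
  coef-invertible (suc (suc (suc (suc (suc (suc (suc S))))))) 0 = T4-invertible 0
  coef-invertible (suc (suc (suc (suc (suc (suc (suc S))))))) 1 = T4-invertible 1
  coef-invertible (suc (suc (suc (suc (suc (suc (suc S))))))) 2 = T4-invertible 2
  coef-invertible (suc (suc (suc (suc (suc (suc (suc S))))))) 3 = T4-invertible 3

  kotzig< : ∀ S t x → kotzig S t x < n
  kotzig< S t = ⟦⟧< (coef S t)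

  kotzig⁻¹< : ∀ S t y → kotzig⁻¹ S t y < n
  kotzig⁻¹< S t = ⟦⟧< (inverse (coef S t))

  kotzig⁻¹-kotzig : ∀ S t {x} → x < n → kotzig⁻¹ S t (kotzig S t x) ≡ x
  kotzig⁻¹-kotzig S t = inverse-⟦⟧ (coef S t) (coef-invertible S t)

  kotzig-kotzig⁻¹ : ∀ S t {y} → y < n → kotzig S t (kotzig⁻¹ S t y) ≡ y
  kotzig-kotzig⁻¹ S t = ⟦⟧-inverse (coef S t) (coef-invertible S t)

  T3-row-sum : ∀ x → sumTo 3 (λ t → kotzig 3 t x) ≡ 3 * h
  T3-row-sum x = begin
    U % n + (W % n + (V % n + 0)) ≡⟨ regroup (U % n) (W % n) (V % n) ⟩
    U % n + V % n + W % n ≡⟨ triple-residues U V W shifted balanced ⟩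
    h + h + h ≡⟨ total h ⟩
    3 * h ∎
    where
    U = h * x + 0
    V = h * x + h
    W = 1 * x + minus-one
    shifted : V ≋ (U + h)
    shifted = ≡⇒≋ (cong (_+ h) (sym (+-identityʳ (h * x))))
    balanced : (W + (U + U) + 1) ≋ 0
    balanced = ≡kn⇒≋0 (x + 1) (expand g x)
      where
      expand : ∀ g x → (1 * x + (suc g + suc g)) + ((suc g * x + 0) + (suc g * x + 0)) + 1 ≡ (x + 1) * suc (suc g + suc g)
      expand = solve-∀
    regroup : ∀ a b c → a + (b + (c + 0)) ≡ a + c + b
    regroup = solve-∀
    total : ∀ h → h + h + h ≡ 3 * h
    total = solve-∀

  T4-row-sum : ∀ x → sumTo 4 (λ t → kotzig 4 t x) ≡ 4 * h
  T4-row-sum x = begin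
    A0 % n + (A1 % n + (A2 % n + (A3 % n + 0))) ≡⟨ regroup (A0 % n) (A1 % n) (A2 % n) (A3 % n) ⟩
    (A0 % n + A2 % n) + (A1 % n + A3 % n) ≡⟨ cong₂ _+_ (pair-residues A0 A2 (≡kn⇒≋0 (x + 1) (expand₁ g x))) (pair-residues A1 A3 (≡kn⇒≋0 (x + 1) (expand₂ g x))) ⟩
    (h + h) + (h + h) ≡⟨ total h ⟩
    4 * h ∎
    where
    A0 = 1 * x + 0
    A1 = minus-one * x + minus-two
    A2 = minus-one * x + minus-one
    A3 = 1 * x + 1
    expand₁ : ∀ g x → (1 * x + 0) + ((suc g + suc g) * x + (suc g + suc g)) + 1 ≡ (x + 1) * suc (suc g + suc g)
    expand₁ = solve-∀
    expand₂ : ∀ g x → ((suc g + suc g) * x + suc (g + g)) + (1 * x + 1) + 1 ≡ (x + 1) * suc (suc g + suc g)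
    expand₂ = solve-∀
    regroup : ∀ a b c d → a + (b + (c + (d + 0))) ≡ (a + c) + (b + d)
    regroup = solve-∀
    total : ∀ h → (h + h) + (h + h) ≡ 4 * h
    total = solve-∀

  T5-row-sum : ∀ x → sumTo 5 (λ t → kotzig 5 t x) ≡ 5 * h
  T5-row-sum x = begin
    A0 % n + (A1 % n + (A2 % n + (A3 % n + (A4 % n + 0)))) ≡⟨ regroup (A0 % n) (A1 % n) (A2 % n) (A3 % n) (A4 % n) ⟩
    (A0 % n + A2 % n) + (A1 % n + A3 % n + A4 % n) ≡⟨ cong₂ _+_ (pair-residues A0 A2 (≡kn⇒≋0 (x + 1) (expand₁ g x))) (triple-residues A1 A3 A4 shifted balanced) ⟩
    (h + h) + (h + h + h) ≡⟨ total h ⟩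
    5 * h ∎
    where
    A0 = 1 * x + 0
    A1 = h * x + g
    A2 = minus-one * x + minus-one
    A3 = h * x + minus-two
    A4 = 1 * x + 2
    expand₁ : ∀ g x → (1 * x + 0) + ((suc g + suc g) * x + (suc g + suc g)) + 1 ≡ (x + 1) * suc (suc g + suc g)
    expand₁ = solve-∀
    shifted : A3 ≋ (A1 + h)
    shifted = ≡⇒≋ (expand g x)
      where
      expand : ∀ g x → suc g * x + suc (g + g) ≡ suc g * x + g + suc g
      expand = solve-∀
    balanced : (A4 + (A1 + A1) + 1) ≋ 0
    balanced = ≡kn⇒≋0 (x + 1) (expand g x)
      where
      expand : ∀ g x → (1 * x + 2) + ((suc g * x + g) + (suc g * x + g)) + 1 ≡ (x + 1) * suc (suc g + suc g)
      expand = solve-∀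
    regroup : ∀ a b c d f → a + (b + (c + (d + (f + 0)))) ≡ (a + c) + (b + d + f)
    regroup = solve-∀
    total : ∀ h → (h + h) + (h + h + h) ≡ 5 * h
    total = solve-∀

  kotzig-row-sum : ∀ S → 3 ≤ S → ∀ x → sumTo S (λ t → kotzig S t x) ≡ S * h
  kotzig-row-sum 0 () x
  kotzig-row-sum 1 (s≤s ()) x
  kotzig-row-sum 2 (s≤s (s≤s ())) x
  kotzig-row-sum 3 _ x = T3-row-sum x
  kotzig-row-sum 4 _ x = T4-row-sum x
  kotzig-row-sum 5 _ x = T5-row-sum x
  kotzig-row-sum 6 _ x = begin
    sumTo 6 (λ t → kotzig 6 t x) ≡⟨ sumTo-++ 3 3 (λ t → kotzig 6 t x) ⟩
    sumTo 3 (λ t → kotzig 3 t x) + sumTo 3 (λ t → kotzig 3 t x) ≡⟨ cong₂ _+_ (T3-row-sum x) (T3-row-sum x) ⟩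
    3 * h + 3 * h ≡⟨ total h ⟩
    6 * h ∎
    where
    total : ∀ h → 3 * h + 3 * h ≡ 6 * h
    total = solve-∀
  kotzig-row-sum (suc (suc (suc (suc (suc (suc (suc S))))))) _ x = begin
    sumTo (4 + (3 + S)) (λ t → kotzig (7 + S) t x) ≡⟨ sumTo-++ 4 (3 + S) (λ t → kotzig (7 + S) t x) ⟩
    sumTo 4 (λ t → kotzig 4 t x) + sumTo (3 + S) (λ t → kotzig (3 + S) t x)
      ≡⟨ cong₂ _+_ (T4-row-sum x) (kotzig-row-sum (suc (suc (suc S))) (m≤m+n 3 S) x) ⟩
    4 * h + (3 + S) * h ≡⟨ total S h ⟩
    (7 + S) * h ∎
    where
    total : ∀ S h → 4 * h + (3 + S) * h ≡ (7 + S) * h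
    total = solve-∀

  Descending : ℕ → (ℕ → ℕ) → Set
  Descending S c = ∀ t → suc t < S → c t ≋ (c (suc t) + 1)

  T3-diagonal-sum : ∀ c → Descending 3 c → sumTo 3 (λ t → kotzig 3 t (c t)) ≡ 3 * h
  T3-diagonal-sum c desc = begin
    V % n + (W % n + (U % n + 0)) ≡⟨ regroup (V % n) (W % n) (U % n) ⟩
    U % n + V % n + W % n ≡⟨ triple-residues U V W shifted balanced ⟩
    h + h + h ≡⟨ total h ⟩
    3 * h ∎
    where
    c0 = c 0
    c1 = c 1
    c2 = c 2
    p0 : c0 ≋ c1 + 1
    p0 = desc 0 (s<s z<s)
    p1 : c1 ≋ c2 + 1
    p1 = desc 1 (s<s (s<s z<s))
    U = h * c2 + h
    V = h * c0 + 0
    W = 1 * c1 + minus-one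
    c02 : c0 ≋ (c2 + 1 + 1)
    c02 = ≋-trans p0 (≋-+ʳ 1 p1)
    shifted : V ≋ (U + h)
    shifted = ≋-trans (≋-+ʳ 0 (≋-*ˡ h c02)) (≡⇒≋ (expand g c2))
      where
      expand : ∀ g c → suc g * (c + 1 + 1) + 0 ≡ suc g * c + suc g + suc g
      expand = solve-∀
    balanced : (W + (U + U) + 1) ≋ 0
    balanced = ≋-trans (≋-+ʳ 1 (≋-+ʳ (U + U) (≋-+ʳ minus-one (≋-*ˡ 1 p1)))) (≡kn⇒≋0 (c2 + 2) (expand g c2))
      where
      expand : ∀ g c → (1 * (c + 1) + (suc g + suc g)) + ((suc g * c + suc g) + (suc g * c + suc g)) + 1 ≡ (c + 2) * suc (suc g + suc g)
      expand = solve-∀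
    regroup : ∀ a b c → a + (b + (c + 0)) ≡ c + a + b
    regroup = solve-∀
    total : ∀ h → h + h + h ≡ 3 * h
    total = solve-∀

  T4-diagonal-sum : ∀ c → Descending 4 c → sumTo 4 (λ t → kotzig 4 t (c t)) ≡ 4 * h
  T4-diagonal-sum c desc = begin
    A0 % n + (A1 % n + (A2 % n + (A3 % n + 0))) ≡⟨ regroup (A0 % n) (A1 % n) (A2 % n) (A3 % n) ⟩
    (A0 % n + A1 % n) + (A2 % n + A3 % n) ≡⟨ cong₂ _+_ (pair-residues A0 A1 pair₁) (pair-residues A2 A3 pair₂) ⟩
    (h + h) + (h + h) ≡⟨ total h ⟩
    4 * h ∎
    where
    c0 = c 0
    c1 = c 1
    c2 = c 2
    c3 = c 3
    p0 : c0 ≋ c1 + 1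
    p0 = desc 0 (s<s z<s)
    p1 : c1 ≋ c2 + 1
    p1 = desc 1 (s<s (s<s z<s))
    p2 : c2 ≋ c3 + 1
    p2 = desc 2 (s<s (s<s (s<s z<s)))
    A0 = 1 * c0 + 0
    A1 = minus-one * c1 + minus-two
    A2 = minus-one * c2 + minus-one
    A3 = 1 * c3 + 1
    pair₁ : (A0 + A1 + 1) ≋ 0
    pair₁ = ≋-trans (≋-+ʳ 1 (≋-+ʳ A1 (≋-+ʳ 0 (≋-*ˡ 1 p0)))) (≡kn⇒≋0 (c1 + 1) (expand g c1))
      where
      expand : ∀ g c → (1 * (c + 1) + 0) + ((suc g + suc g) * c + suc (g + g)) + 1 ≡ (c + 1) * suc (suc g + suc g)
      expand = solve-∀
    pair₂ : (A2 + A3 + 1) ≋ 0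
    pair₂ = ≋-trans (≋-+ʳ 1 (≋-+ʳ A3 (≋-+ʳ minus-one (≋-*ˡ minus-one p2)))) (≡kn⇒≋0 (c3 + 2) (expand g c3))
      where
      expand : ∀ g c → ((suc g + suc g) * (c + 1) + (suc g + suc g)) + (1 * c + 1) + 1 ≡ (c + 2) * suc (suc g + suc g)
      expand = solve-∀
    regroup : ∀ a b c d → a + (b + (c + (d + 0))) ≡ (a + b) + (c + d)
    regroup = solve-∀
    total : ∀ h → (h + h) + (h + h) ≡ 4 * h
    total = solve-∀

  T5-diagonal-sum : ∀ c → Descending 5 c → sumTo 5 (λ t → kotzig 5 t (c t)) ≡ 5 * h
  T5-diagonal-sum c desc = begin
    A0 % n + (A1 % n + (A2 % n + (A3 % n + (A4 % n + 0)))) ≡⟨ regroup (A0 % n) (A1 % n) (A2 % n) (A3 % n) (A4 % n) ⟩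
    (A2 % n + A4 % n) + (A3 % n + A1 % n + A0 % n) ≡⟨ cong₂ _+_ (pair-residues A2 A4 pair₁) (triple-residues A3 A1 A0 shifted balanced) ⟩
    (h + h) + (h + h + h) ≡⟨ total h ⟩
    5 * h ∎
    where
    c0 = c 0
    c1 = c 1
    c2 = c 2
    c3 = c 3
    c4 = c 4
    p0 : c0 ≋ c1 + 1
    p0 = desc 0 (s<s z<s)
    p1 : c1 ≋ c2 + 1
    p1 = desc 1 (s<s (s<s z<s))
    p2 : c2 ≋ c3 + 1
    p2 = desc 2 (s<s (s<s (s<s z<s)))
    p3 : c3 ≋ c4 + 1
    p3 = desc 3 (s<s (s<s (s<s (s<s z<s))))
    A0 = 1 * c0 + 0
    A1 = h * c1 + g
    A2 = minus-one * c2 + minus-one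
    A3 = h * c3 + minus-two
    A4 = 1 * c4 + 2
    c24 : c2 ≋ (c4 + 1 + 1)
    c24 = ≋-trans p2 (≋-+ʳ 1 p3)
    c13 : c1 ≋ (c3 + 1 + 1)
    c13 = ≋-trans p1 (≋-+ʳ 1 p2)
    c03 : c0 ≋ (c3 + 1 + 1 + 1)
    c03 = ≋-trans p0 (≋-+ʳ 1 c13)
    pair₁ : (A2 + A4 + 1) ≋ 0
    pair₁ = ≋-trans (≋-+ʳ 1 (≋-+ʳ A4 (≋-+ʳ minus-one (≋-*ˡ minus-one c24)))) (≡kn⇒≋0 (c4 + 3) (expand g c4))
      where
      expand : ∀ g c → ((suc g + suc g) * (c + 1 + 1) + (suc g + suc g)) + (1 * c + 2) + 1 ≡ (c + 3) * suc (suc g + suc g)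
      expand = solve-∀
    shifted : A1 ≋ (A3 + h)
    shifted = ≋-trans (≋-+ʳ g (≋-*ˡ h c13)) (≡⇒≋ (expand g c3))
      where
      expand : ∀ g c → suc g * (c + 1 + 1) + g ≡ suc g * c + suc (g + g) + suc g
      expand = solve-∀
    balanced : (A0 + (A3 + A3) + 1) ≋ 0
    balanced = ≋-trans (≋-+ʳ 1 (≋-+ʳ (A3 + A3) (≋-+ʳ 0 (≋-*ˡ 1 c03)))) (≡kn⇒≋0 (c3 + 2) (expand g c3))
      where
      expand : ∀ g c → (1 * (c + 1 + 1 + 1) + 0) + ((suc g * c + suc (g + g)) + (suc g * c + suc (g + g))) + 1 ≡ (c + 2) * suc (suc g + suc g)
      expand = solve-∀
    regroup : ∀ a b c d f → a + (b + (c + (d + (f + 0)))) ≡ (c + f) + (d + b + a)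
    regroup = solve-∀
    total : ∀ h → (h + h) + (h + h + h) ≡ 5 * h
    total = solve-∀

  kotzig-diagonal-sum : ∀ S → 3 ≤ S → ∀ c → Descending S c → sumTo S (λ t → kotzig S t (c t)) ≡ S * h
  kotzig-diagonal-sum 0 ()
  kotzig-diagonal-sum 1 (s≤s ())
  kotzig-diagonal-sum 2 (s≤s (s≤s ()))
  kotzig-diagonal-sum 3 _ = T3-diagonal-sum
  kotzig-diagonal-sum 4 _ = T4-diagonal-sum
  kotzig-diagonal-sum 5 _ = T5-diagonal-sum
  kotzig-diagonal-sum 6 _ c desc = begin
    sumTo 6 (λ t → kotzig 6 t (c t))                                          ≡⟨ sumTo-++ 3 3 (λ t → kotzig 6 t (c t)) ⟩
    sumTo 3 (λ t → kotzig 3 t (c t)) + sumTo 3 (λ t → kotzig 3 t (c (3 + t)))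
      ≡⟨ cong₂ _+_ (T3-diagonal-sum c (λ t st → desc t (<-≤-trans st (m≤m+n 3 3))))
                   (T3-diagonal-sum (λ t → c (3 + t)) (λ t st → desc (3 + t) (+-monoʳ-< 3 st))) ⟩
    3 * h + 3 * h                                                             ≡⟨ total h ⟩
    6 * h                                                                     ∎
    where
    total : ∀ h → 3 * h + 3 * h ≡ 6 * h
    total = solve-∀
  kotzig-diagonal-sum (suc (suc (suc (suc (suc (suc (suc S))))))) _ c desc = begin
    sumTo (4 + (3 + S)) (λ t → kotzig (7 + S) t (c t))
      ≡⟨ sumTo-++ 4 (3 + S) (λ t → kotzig (7 + S) t (c t)) ⟩
    sumTo 4 (λ t → kotzig 4 t (c t)) + sumTo (3 + S) (λ t → kotzig (3 + S) t (c (4 + t)))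
      ≡⟨ cong₂ _+_ (T4-diagonal-sum c (λ t st → desc t (<-≤-trans st (m≤m+n 4 (3 + S)))))
                   (kotzig-diagonal-sum (suc (suc (suc S))) (m≤m+n 3 S) (λ t → c (4 + t)) (λ t st → desc (4 + t) (+-monoʳ-< 4 st))) ⟩
    4 * h + (3 + S) * h
      ≡⟨ total S h ⟩
    (7 + S) * h ∎
    where
    total : ∀ S h → 4 * h + (3 + S) * h ≡ (7 + S) * h
    total = solve-∀

module OddFilling (gM gA gB S : ℕ) (3≤S : 3 ≤ S) where
  module KM = AffineKotzig gM
  module KA = AffineKotzig gA
  module KB = AffineKotzig gB

  M A B : ℕ
  M = KM.n
  A = KA.n
  B = KB.n

  open Band A B M S
  open Cyclic M using (_⊖_; ⊖-suc)

  σ σ⁻¹ : ℕ → Digits → Digits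
  σ   t (i1 , i2 , j2) = KM.kotzig S t i1 , KA.kotzig S t i2 , KB.kotzig S t j2
  σ⁻¹ t (h , y , x)    = KM.kotzig⁻¹ S t h , KA.kotzig⁻¹ S t y , KB.kotzig⁻¹ S t x

  layers : LayerPermutation M A B
  layers = record
    { σ         = σ
    ; σ⁻¹       = σ⁻¹
    ; σ-range   = λ { t {i1 , i2 , j2} _ → KM.kotzig< S t i1 , KA.kotzig< S t i2 , KB.kotzig< S t j2 }
    ; σ⁻¹-range = λ { t {h , y , x} _ → KM.kotzig⁻¹< S t h , KA.kotzig⁻¹< S t y , KB.kotzig⁻¹< S t x }
    ; σ⁻¹∘σ     = λ { t {i1 , i2 , j2} (i1<M , i2<A , j2<B) →
                    cong₂ _,_ (KM.kotzig⁻¹-kotzig S t i1<M) (cong₂ _,_ (KA.kotzig⁻¹-kotzig S t i2<A) (KB.kotzig⁻¹-kotzig S t j2<B)) }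
    ; σ∘σ⁻¹     = λ { t {h , y , x} (h<M , y<A , x<B) →
                    cong₂ _,_ (KM.kotzig-kotzig⁻¹ S t h<M) (cong₂ _,_ (KA.kotzig-kotzig⁻¹ S t y<A) (KB.kotzig-kotzig⁻¹ S t x<B)) }
    }

  sumTo-low : ∀ k (y x : ℕ → ℕ → ℕ) →
    sumTo S (λ t → sumTo k (λ j → y t j * B + x t j)) ≡ sumTo S (λ t → sumTo k (y t)) * B + sumTo S (λ t → sumTo k (x t))
  sumTo-low k y x = begin
    sumTo S (λ t → sumTo k (λ j → y t j * B + x t j))
      ≡⟨ sumTo-cong S (λ t _ → trans (sumTo-+ k _ (x t)) (cong (_+ sumTo k (x t)) (sumTo-*ʳ k (y t) B))) ⟩
    sumTo S (λ t → sumTo k (y t) * B + sumTo k (x t))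
      ≡⟨ sumTo-+ S _ _ ⟩
    sumTo S (λ t → sumTo k (y t) * B) + sumTo S (λ t → sumTo k (x t))
      ≡⟨ cong (_+ sumTo S (λ t → sumTo k (x t))) (sumTo-*ʳ S (λ t → sumTo k (y t)) B) ⟩
    sumTo S (λ t → sumTo k (y t)) * B + sumTo S (λ t → sumTo k (x t)) ∎

  rowSum : ℕ
  rowSum = B * (sumTo S (λ t → t) * (M * A * B)) + B * (S * KM.h) * (A * B) + (B * (S * KA.h) * B + B * (S * KB.h))

  row-sum : ∀ {i1 i2} → i1 < M → i2 < A → sumTo S (λ t → sumTo B (λ j2 → entry layers t (i1 , i2 , j2))) ≡ rowSum
  row-sum {i1} {i2} _ _ = begin
    sumTo S (λ t → sumTo B (λ j2 → entry layers t (i1 , i2 , j2)))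
      ≡⟨ sumTo-encode B (λ t j2 → σ t (i1 , i2 , j2)) ⟩
    B * (sumTo S (λ t → t) * (M * A * B))
      + sumTo S (λ t → sumTo B (λ _ → KM.kotzig S t i1)) * (A * B)
      + sumTo S (λ t → sumTo B (λ j2 → KA.kotzig S t i2 * B + KB.kotzig S t j2))
      ≡⟨ cong₂ (λ a b → B * (sumTo S (λ t → t) * (M * A * B)) + a * (A * B) + b) high-sum low-sum ⟩
    rowSum ∎
    where
    high-sum : sumTo S (λ t → sumTo B (λ _ → KM.kotzig S t i1)) ≡ B * (S * KM.h)
    high-sum = trans (sumTo-nested-const S B (λ t → KM.kotzig S t i1)) (cong (B *_) (KM.kotzig-row-sum S 3≤S i1))
    low-sum : sumTo S (λ t → sumTo B (λ j2 → KA.kotzig S t i2 * B + KB.kotzig S t j2)) ≡ B * (S * KA.h) * B + B * (S * KB.h)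
    low-sum = begin
      sumTo S (λ t → sumTo B (λ j2 → KA.kotzig S t i2 * B + KB.kotzig S t j2))
        ≡⟨ sumTo-low B (λ t _ → KA.kotzig S t i2) (λ t j2 → KB.kotzig S t j2) ⟩
      sumTo S (λ t → sumTo B (λ _ → KA.kotzig S t i2)) * B + sumTo S (λ t → sumTo B (λ j2 → KB.kotzig S t j2))
        ≡⟨ cong₂ (λ a b → a * B + b) (sumTo-nested-const S B (λ t → KA.kotzig S t i2)) (sumTo-swap S B (λ t j2 → KB.kotzig S t j2)) ⟩
      B * sumTo S (λ t → KA.kotzig S t i2) * B + sumTo B (λ j2 → sumTo S (λ t → KB.kotzig S t j2))
        ≡⟨ cong₂ (λ a b → B * a * B + b) (KA.kotzig-row-sum S 3≤S i2)
                 (trans (sumTo-cong B (λ j2 _ → KB.kotzig-row-sum S 3≤S j2)) (sumTo-const B (S * KB.h))) ⟩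
      B * (S * KA.h) * B + B * (S * KB.h) ∎

  colSum : ℕ
  colSum = A * (sumTo S (λ t → t) * (M * A * B)) + A * (S * KM.h) * (A * B) + (A * (S * KA.h) * B + A * (S * KB.h))

  col-sum : S ≤ M → ∀ {j1 j2} → j1 < M → j2 < B →
            sumTo S (λ t → sumTo A (λ i2 → entry layers t (j1 ⊖ t , i2 , j2))) ≡ colSum
  col-sum S≤M {j1} {j2} _ _ = begin
    sumTo S (λ t → sumTo A (λ i2 → entry layers t (j1 ⊖ t , i2 , j2)))
      ≡⟨ sumTo-encode A (λ t i2 → σ t (j1 ⊖ t , i2 , j2)) ⟩
    A * (sumTo S (λ t → t) * (M * A * B))
      + sumTo S (λ t → sumTo A (λ _ → KM.kotzig S t (j1 ⊖ t))) * (A * B)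
      + sumTo S (λ t → sumTo A (λ i2 → KA.kotzig S t i2 * B + KB.kotzig S t j2))
      ≡⟨ cong₂ (λ a b → A * (sumTo S (λ t → t) * (M * A * B)) + a * (A * B) + b) high-sum low-sum ⟩
    colSum ∎
    where
    descending : KM.Descending S (j1 ⊖_)
    descending t st<S = ⊖-suc j1 (<-≤-trans st<S S≤M)
    high-sum : sumTo S (λ t → sumTo A (λ _ → KM.kotzig S t (j1 ⊖ t))) ≡ A * (S * KM.h)
    high-sum = trans (sumTo-nested-const S A (λ t → KM.kotzig S t (j1 ⊖ t)))
                     (cong (A *_) (KM.kotzig-diagonal-sum S 3≤S (j1 ⊖_) descending))
    low-sum : sumTo S (λ t → sumTo A (λ i2 → KA.kotzig S t i2 * B + KB.kotzig S t j2)) ≡ A * (S * KA.h) * B + A * (S * KB.h)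
    low-sum = begin
      sumTo S (λ t → sumTo A (λ i2 → KA.kotzig S t i2 * B + KB.kotzig S t j2))
        ≡⟨ sumTo-low A (λ t i2 → KA.kotzig S t i2) (λ t _ → KB.kotzig S t j2) ⟩
      sumTo S (λ t → sumTo A (λ i2 → KA.kotzig S t i2)) * B + sumTo S (λ t → sumTo A (λ _ → KB.kotzig S t j2))
        ≡⟨ cong₂ (λ a b → a * B + b) (sumTo-swap S A (λ t i2 → KA.kotzig S t i2)) (sumTo-nested-const S A (λ t → KB.kotzig S t j2)) ⟩
      sumTo A (λ i2 → sumTo S (λ t → KA.kotzig S t i2)) * B + A * sumTo S (λ t → KB.kotzig S t j2)
        ≡⟨ cong₂ (λ a b → a * B + A * b)
                 (trans (sumTo-cong A (λ i2 _ → KA.kotzig-row-sum S 3≤S i2)) (sumTo-const A (S * KA.h)))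
                 (KB.kotzig-row-sum S 3≤S j2) ⟩
      A * (S * KA.h) * B + A * (S * KB.h) ∎

  magicRectangle : S ≤ M → MagicRectangle (A * M) (B * M) (B * S) (A * S)
  magicRectangle S≤M = Construction.magicRectangle S≤M record
    { layers = layers ; rowSum = rowSum ; colSum = colSum ; row-sum = row-sum ; col-sum = col-sum S≤M }

-- Even layers: checkerboard reflections of ℤ/M and reflections of an A × B grid

odd : ℕ → Bool
odd zero    = false
odd (suc n) = not (odd n)

mirror : ℕ → Bool → ℕ → ℕ
mirror n b x = if b then n ∸ suc x else x

n∸suc<n : ∀ {n x} → x < n → n ∸ suc x < n
n∸suc<n {suc n} {x} (s≤s x≤n) = s≤s (m∸n≤m n x)

n∸suc-involutive : ∀ {n x} → x < n → n ∸ suc (n ∸ suc x) ≡ x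
n∸suc-involutive {suc n} (s≤s x≤n) = m∸[m∸n]≡n x≤n

x+[n∸suc-x]≡n∸1 : ∀ {n x} → x < n → x + (n ∸ suc x) ≡ n ∸ 1
x+[n∸suc-x]≡n∸1 {suc n} (s≤s x≤n) = m+[n∸m]≡n x≤n

mirror< : ∀ {n} b {x} → x < n → mirror n b x < n
mirror< true  = n∸suc<n
mirror< false x<n = x<n

mirror-involutive : ∀ {n} b {x} → x < n → mirror n b (mirror n b x) ≡ x
mirror-involutive true  = n∸suc-involutive
mirror-involutive false _ = refl

mirror-+-mirror-not : ∀ {n} b {x} → x < n → mirror n b x + mirror n (not b) x ≡ n ∸ 1
mirror-+-mirror-not true  {x} x<n = trans (+-comm _ x) (x+[n∸suc-x]≡n∸1 x<n)
mirror-+-mirror-not false x<n = x+[n∸suc-x]≡n∸1 x<n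

sumTo-mirror : ∀ n b → sumTo n (mirror n b) ≡ sumTo n (λ j → j)
sumTo-mirror n true  = sumTo-reverse n (λ j → j)
sumTo-mirror n false = refl

sumTo-mirror-odd : ∀ k c {n x} → x < n → sumTo (k * 2) (λ i → mirror n (odd (i + c)) x) ≡ k * (n ∸ 1)
sumTo-mirror-odd k c {n} {x} x<n = begin
  sumTo (k * 2) f                                  ≡⟨ sumTo-blocks k 2 f ⟩
  sumTo k (λ q → f (q * 2 + 0) + (f (q * 2 + 1) + 0)) ≡⟨ sumTo-cong k (λ q _ → adjacent q) ⟩
  sumTo k (λ _ → n ∸ 1)                            ≡⟨ sumTo-const k (n ∸ 1) ⟩
  k * (n ∸ 1)                                      ∎
  where
  f : ℕ → ℕ
  f i = mirror n (odd (i + c)) x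
  adjacent : ∀ q → f (q * 2 + 0) + (f (q * 2 + 1) + 0) ≡ n ∸ 1
  adjacent q = begin
    f (q * 2 + 0) + (f (q * 2 + 1) + 0)  ≡⟨ cong₂ (λ a b → f a + b) (+-identityʳ (q * 2)) (+-identityʳ _) ⟩
    f (q * 2) + f (q * 2 + 1)            ≡⟨ cong (λ z → f (q * 2) + mirror n (odd (z + c)) x) (+-comm (q * 2) 1) ⟩
    f (q * 2) + mirror n (not (odd (q * 2 + c))) x ≡⟨ mirror-+-mirror-not (odd (q * 2 + c)) x<n ⟩
    n ∸ 1                                ∎

sumTo-mirror-half : ∀ k {n x} → sumTo (k * 2) (λ j → mirror n (j <ᵇ k) x) ≡ k * (n ∸ suc x) + k * x
sumTo-mirror-half k {n} {x} = begin
  sumTo (k * 2) g                                  ≡⟨ cong (λ z → sumTo z g) (trans (*-comm k 2) (cong (k +_) (+-identityʳ k))) ⟩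
  sumTo (k + k) g                                  ≡⟨ sumTo-++ k k g ⟩
  sumTo k g + sumTo k (λ j → g (k + j))
    ≡⟨ cong₂ _+_ (sumTo-cong k (λ j j<k → cong (λ b → mirror n b x) (<ᵇ-true j<k)))
                 (sumTo-cong k (λ j _ → cong (λ b → mirror n b x) (<ᵇ-false (≤⇒≯ (m≤m+n k j))))) ⟩
  sumTo k (λ _ → n ∸ suc x) + sumTo k (λ _ → x)    ≡⟨ cong₂ _+_ (sumTo-const k _) (sumTo-const k x) ⟩
  k * (n ∸ suc x) + k * x                          ∎
  where
  g : ℕ → ℕ
  g j = mirror n (j <ᵇ k) x

-- Layers come in straight/reversed pairs, plus a final triple when S is odd; over each such
-- group the grid values (Y, X) have constant row and column weights.
data Shape : Set where
  straight reversed tri₀ tri₁ tri₂ : Shape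

shape : ℕ → ℕ → Shape
shape 2 0 = straight
shape 2 1 = reversed
shape 3 0 = tri₀
shape 3 1 = tri₁
shape 3 (suc (suc _)) = tri₂
shape (suc (suc (suc (suc S)))) 0 = straight
shape (suc (suc (suc (suc S)))) 1 = reversed
shape (suc (suc (suc (suc S)))) (suc (suc t)) = shape (suc (suc S)) t
shape _ _ = straight

module GridReflections (a′ b′ : ℕ) where
  A′ = suc a′
  B′ = suc b′
  A = A′ * 2
  B = B′ * 2

  Y : Shape → ℕ → ℕ → ℕ
  Y straight i j = i
  Y reversed i j = A ∸ suc i
  Y tri₀ i j = i
  Y tri₁ i j = A ∸ suc i
  Y tri₂ i j = mirror A (j <ᵇ B′) i

  X : Shape → ℕ → ℕ → ℕ
  X straight i j = j
  X reversed i j = B ∸ suc j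
  X tri₀ i j = B ∸ suc j
  X tri₁ i j = mirror B (i <ᵇ A′) j
  X tri₂ i j = j

  I : Shape → ℕ → ℕ → ℕ
  I straight y x = y
  I reversed y x = A ∸ suc y
  I tri₀ y x = y
  I tri₁ y x = A ∸ suc y
  I tri₂ y x = mirror A (x <ᵇ B′) y

  J : Shape → ℕ → ℕ → ℕ
  J straight y x = x
  J reversed y x = B ∸ suc x
  J tri₀ y x = B ∸ suc x
  J tri₁ y x = mirror B ((A ∸ suc y) <ᵇ A′) x
  J tri₂ y x = x

  Y< : ∀ k {i j} → i < A → j < B → Y k i j < A
  Y< straight i<A j<B = i<A
  Y< reversed i<A j<B = n∸suc<n i<A
  Y< tri₀ i<A j<B = i<A
  Y< tri₁ i<A j<B = n∸suc<n i<A
  Y< tri₂ {i} {j} i<A j<B = mirror< (j <ᵇ B′) i<A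

  X< : ∀ k {i j} → i < A → j < B → X k i j < B
  X< straight i<A j<B = j<B
  X< reversed i<A j<B = n∸suc<n j<B
  X< tri₀ i<A j<B = n∸suc<n j<B
  X< tri₁ {i} i<A j<B = mirror< (i <ᵇ A′) j<B
  X< tri₂ i<A j<B = j<B

  I< : ∀ k {y x} → y < A → x < B → I k y x < A
  I< straight y<A x<B = y<A
  I< reversed y<A x<B = n∸suc<n y<A
  I< tri₀ y<A x<B = y<A
  I< tri₁ y<A x<B = n∸suc<n y<A
  I< tri₂ {y} {x} y<A x<B = mirror< (x <ᵇ B′) y<A

  J< : ∀ k {y x} → y < A → x < B → J k y x < B
  J< straight y<A x<B = x<B
  J< reversed y<A x<B = n∸suc<n x<B
  J< tri₀ y<A x<B = n∸suc<n x<B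
  J< tri₁ {y} y<A x<B = mirror< ((A ∸ suc y) <ᵇ A′) x<B
  J< tri₂ y<A x<B = x<B

  I∘Y,X : ∀ k {i j} → i < A → j < B → I k (Y k i j) (X k i j) ≡ i
  I∘Y,X straight i<A j<B = refl
  I∘Y,X reversed i<A j<B = n∸suc-involutive i<A
  I∘Y,X tri₀ i<A j<B = refl
  I∘Y,X tri₁ i<A j<B = n∸suc-involutive i<A
  I∘Y,X tri₂ {i} {j} i<A j<B = mirror-involutive (j <ᵇ B′) i<A

  J∘Y,X : ∀ k {i j} → i < A → j < B → J k (Y k i j) (X k i j) ≡ j
  J∘Y,X straight i<A j<B = refl
  J∘Y,X reversed i<A j<B = n∸suc-involutive j<B
  J∘Y,X tri₀ i<A j<B = n∸suc-involutive j<B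
  J∘Y,X tri₁ {i} {j} i<A j<B = trans (cong (λ z → mirror B (z <ᵇ A′) (mirror B (i <ᵇ A′) j)) (n∸suc-involutive i<A)) (mirror-involutive (i <ᵇ A′) j<B)
  J∘Y,X tri₂ i<A j<B = refl

  Y∘I,J : ∀ k {y x} → y < A → x < B → Y k (I k y x) (J k y x) ≡ y
  Y∘I,J straight y<A x<B = refl
  Y∘I,J reversed y<A x<B = n∸suc-involutive y<A
  Y∘I,J tri₀ y<A x<B = refl
  Y∘I,J tri₁ y<A x<B = n∸suc-involutive y<A
  Y∘I,J tri₂ {y} {x} y<A x<B = mirror-involutive (x <ᵇ B′) y<A

  X∘I,J : ∀ k {y x} → y < A → x < B → X k (I k y x) (J k y x) ≡ x
  X∘I,J straight y<A x<B = refl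
  X∘I,J reversed y<A x<B = n∸suc-involutive x<B
  X∘I,J tri₀ y<A x<B = n∸suc-involutive x<B
  X∘I,J tri₁ {y} y<A x<B = mirror-involutive ((A ∸ suc y) <ᵇ A′) x<B
  X∘I,J tri₂ y<A x<B = refl

  rowWeight : Shape → ℕ → ℕ
  rowWeight k i2 = sumTo B (λ j → Y k i2 j * B + X k i2 j)

  colWeight : Shape → ℕ → ℕ
  colWeight k j2 = sumTo A (λ i → Y k i j2 * B + X k i j2)

  ΔA ΔB : ℕ
  ΔA = sumTo A (λ j → j)
  ΔB = sumTo B (λ j → j)

  pairRow tripleRow pairCol tripleCol : ℕ
  pairRow = B * (A ∸ 1) * B + (ΔB + ΔB)
  tripleRow = (B + B′) * (A ∸ 1) * B + (ΔB + (ΔB + ΔB))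
  pairCol = (ΔA * B + ΔA * B) + A * (B ∸ 1)
  tripleCol = (ΔA * B + (ΔA * B + ΔA * B)) + (A + A′) * (B ∸ 1)

  pair-row : ∀ {i2} → i2 < A → sumTo 2 (λ t → rowWeight (shape 2 t) i2) ≡ pairRow
  pair-row {i2} i2<A = begin
    rowWeight straight i2 + (rowWeight reversed i2 + 0)
      ≡⟨ cong₂ (λ a b → a + (b + 0)) (sumTo-*+ B (λ _ → i2) (λ j → j) B) (sumTo-*+ B (λ _ → A ∸ suc i2) (λ j → B ∸ suc j) B) ⟩
    sumTo B (λ _ → i2) * B + ΔB + (sumTo B (λ _ → A ∸ suc i2) * B + sumTo B (λ j → B ∸ suc j) + 0)
      ≡⟨ cong₂ (λ a b → a * B + ΔB + (b * B + sumTo B (λ j → B ∸ suc j) + 0)) (sumTo-const B i2) (sumTo-const B (A ∸ suc i2)) ⟩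
    B * i2 * B + ΔB + (B * (A ∸ suc i2) * B + sumTo B (λ j → B ∸ suc j) + 0)
      ≡⟨ cong (λ z → B * i2 * B + ΔB + (B * (A ∸ suc i2) * B + z + 0)) (sumTo-reverse B (λ j → j)) ⟩
    B * i2 * B + ΔB + (B * (A ∸ suc i2) * B + ΔB + 0) ≡⟨ regroup i2 (A ∸ suc i2) B ΔB ⟩
    B * (i2 + (A ∸ suc i2)) * B + (ΔB + ΔB) ≡⟨ cong (λ z → B * z * B + (ΔB + ΔB)) (x+[n∸suc-x]≡n∸1 i2<A) ⟩
    pairRow ∎
    where
    regroup : ∀ x y B ΔB → B * x * B + ΔB + (B * y * B + ΔB + 0) ≡ B * (x + y) * B + (ΔB + ΔB)
    regroup = solve-∀

  triple-row : ∀ {i2} → i2 < A → sumTo 3 (λ t → rowWeight (shape 3 t) i2) ≡ tripleRow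
  triple-row {i2} i2<A = begin
    rowWeight tri₀ i2 + (rowWeight tri₁ i2 + (rowWeight tri₂ i2 + 0))
      ≡⟨ cong₃ (λ a b c → a + (b + (c + 0))) (sumTo-*+ B (λ _ → i2) (λ j → B ∸ suc j) B) (sumTo-*+ B (λ _ → A ∸ suc i2) (λ j → mirror B (i2 <ᵇ A′) j) B)
               (sumTo-*+ B (λ j → mirror A (j <ᵇ B′) i2) (λ j → j) B) ⟩
    sumTo B (λ _ → i2) * B + sumTo B (λ j → B ∸ suc j) + (sumTo B (λ _ → A ∸ suc i2) * B + sumTo B (λ j → mirror B (i2 <ᵇ A′) j)
      + (sumTo B (λ j → mirror A (j <ᵇ B′) i2) * B + ΔB + 0))
      ≡⟨ cong₃ (λ a b c → a * B + sumTo B (λ j → B ∸ suc j) + (b * B + sumTo B (λ j → mirror B (i2 <ᵇ A′) j) + (c * B + ΔB + 0)))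
               (sumTo-const B i2) (sumTo-const B (A ∸ suc i2)) (sumTo-mirror-half B′ {A} {i2}) ⟩
    B * i2 * B + sumTo B (λ j → B ∸ suc j) + (B * (A ∸ suc i2) * B + sumTo B (λ j → mirror B (i2 <ᵇ A′) j)
      + ((B′ * (A ∸ suc i2) + B′ * i2) * B + ΔB + 0))
      ≡⟨ cong₂ (λ a b → B * i2 * B + a + (B * (A ∸ suc i2) * B + b + ((B′ * (A ∸ suc i2) + B′ * i2) * B + ΔB + 0)))
               (sumTo-reverse B (λ j → j)) (sumTo-mirror B (i2 <ᵇ A′)) ⟩
    B * i2 * B + ΔB + (B * (A ∸ suc i2) * B + ΔB + ((B′ * (A ∸ suc i2) + B′ * i2) * B + ΔB + 0))
      ≡⟨ regroup i2 (A ∸ suc i2) B B′ ΔB ⟩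
    (B + B′) * (i2 + (A ∸ suc i2)) * B + (ΔB + (ΔB + ΔB)) ≡⟨ cong (λ z → (B + B′) * z * B + (ΔB + (ΔB + ΔB))) (x+[n∸suc-x]≡n∸1 i2<A) ⟩
    tripleRow ∎
    where
    regroup : ∀ x y B B′ ΔB → B * x * B + ΔB + (B * y * B + ΔB + ((B′ * y + B′ * x) * B + ΔB + 0)) ≡ (B + B′) * (x + y) * B + (ΔB + (ΔB + ΔB))
    regroup = solve-∀

  pair-col : ∀ {j2} → j2 < B → sumTo 2 (λ t → colWeight (shape 2 t) j2) ≡ pairCol
  pair-col {j2} j2<B = begin
    colWeight straight j2 + (colWeight reversed j2 + 0)
      ≡⟨ cong₂ (λ a b → a + (b + 0)) (sumTo-*+ A (λ i → i) (λ _ → j2) B) (sumTo-*+ A (λ i → A ∸ suc i) (λ _ → B ∸ suc j2) B) ⟩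
    ΔA * B + sumTo A (λ _ → j2) + (sumTo A (λ i → A ∸ suc i) * B + sumTo A (λ _ → B ∸ suc j2) + 0)
      ≡⟨ cong₃ (λ a b c → ΔA * B + a + (b * B + c + 0)) (sumTo-const A j2) (sumTo-reverse A (λ j → j)) (sumTo-const A (B ∸ suc j2)) ⟩
    ΔA * B + A * j2 + (ΔA * B + A * (B ∸ suc j2) + 0) ≡⟨ regroup j2 (B ∸ suc j2) A (ΔA * B) ⟩
    (ΔA * B + ΔA * B) + A * (j2 + (B ∸ suc j2)) ≡⟨ cong (λ z → (ΔA * B + ΔA * B) + A * z) (x+[n∸suc-x]≡n∸1 j2<B) ⟩
    pairCol ∎
    where
    regroup : ∀ x y A t → t + A * x + (t + A * y + 0) ≡ (t + t) + A * (x + y)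
    regroup = solve-∀

  triple-col : ∀ {j2} → j2 < B → sumTo 3 (λ t → colWeight (shape 3 t) j2) ≡ tripleCol
  triple-col {j2} j2<B = begin
    colWeight tri₀ j2 + (colWeight tri₁ j2 + (colWeight tri₂ j2 + 0))
      ≡⟨ cong₃ (λ a b c → a + (b + (c + 0))) (sumTo-*+ A (λ i → i) (λ _ → B ∸ suc j2) B) (sumTo-*+ A (λ i → A ∸ suc i) (λ i → mirror B (i <ᵇ A′) j2) B)
               (sumTo-*+ A (λ i → mirror A (j2 <ᵇ B′) i) (λ _ → j2) B) ⟩
    ΔA * B + sumTo A (λ _ → B ∸ suc j2) + (sumTo A (λ i → A ∸ suc i) * B + sumTo A (λ i → mirror B (i <ᵇ A′) j2)
      + (sumTo A (λ i → mirror A (j2 <ᵇ B′) i) * B + sumTo A (λ _ → j2) + 0))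
      ≡⟨ cong₃ (λ a b c → ΔA * B + a + (b * B + sumTo A (λ i → mirror B (i <ᵇ A′) j2) + (c * B + sumTo A (λ _ → j2) + 0)))
               (sumTo-const A (B ∸ suc j2)) (sumTo-reverse A (λ j → j)) (sumTo-mirror A (j2 <ᵇ B′)) ⟩
    ΔA * B + A * (B ∸ suc j2) + (ΔA * B + sumTo A (λ i → mirror B (i <ᵇ A′) j2) + (ΔA * B + sumTo A (λ _ → j2) + 0))
      ≡⟨ cong₂ (λ a b → ΔA * B + A * (B ∸ suc j2) + (ΔA * B + a + (ΔA * B + b + 0))) (sumTo-mirror-half A′ {B} {j2}) (sumTo-const A j2) ⟩
    ΔA * B + A * (B ∸ suc j2) + (ΔA * B + (A′ * (B ∸ suc j2) + A′ * j2) + (ΔA * B + A * j2 + 0))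
      ≡⟨ regroup j2 (B ∸ suc j2) A A′ (ΔA * B) ⟩
    (ΔA * B + (ΔA * B + ΔA * B)) + (A + A′) * (j2 + (B ∸ suc j2)) ≡⟨ cong (λ z → (ΔA * B + (ΔA * B + ΔA * B)) + (A + A′) * z) (x+[n∸suc-x]≡n∸1 j2<B) ⟩
    tripleCol ∎
    where
    regroup : ∀ x y A A′ t → t + A * y + (t + (A′ * y + A′ * x) + (t + A * x + 0)) ≡ (t + (t + t)) + (A + A′) * (x + y)
    regroup = solve-∀

  rowTotal colTotal : ℕ → ℕ
  rowTotal 2 = pairRow
  rowTotal 3 = tripleRow
  rowTotal (suc (suc (suc (suc n)))) = pairRow + rowTotal (suc (suc n))
  rowTotal _ = 0
  colTotal 2 = pairCol
  colTotal 3 = tripleCol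
  colTotal (suc (suc (suc (suc n)))) = pairCol + colTotal (suc (suc n))
  colTotal _ = 0

  shapes-row-sum : ∀ n → 2 ≤ n → ∀ {i2} → i2 < A → sumTo n (λ t → rowWeight (shape n t) i2) ≡ rowTotal n
  shapes-row-sum 0 ()
  shapes-row-sum 1 (s≤s ())
  shapes-row-sum 2 _ = pair-row
  shapes-row-sum 3 _ = triple-row
  shapes-row-sum (suc (suc (suc (suc n)))) _ {i2} i2<A =
    trans (sumTo-++ 2 (suc (suc n)) (λ t → rowWeight (shape (4 + n) t) i2))
          (cong₂ _+_ (pair-row i2<A) (shapes-row-sum (suc (suc n)) (s≤s (s≤s z≤n)) i2<A))

  shapes-col-sum : ∀ n → 2 ≤ n → ∀ {j2} → j2 < B → sumTo n (λ t → colWeight (shape n t) j2) ≡ colTotal n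
  shapes-col-sum 0 ()
  shapes-col-sum 1 (s≤s ())
  shapes-col-sum 2 _ = pair-col
  shapes-col-sum 3 _ = triple-col
  shapes-col-sum (suc (suc (suc (suc n)))) _ {j2} j2<B =
    trans (sumTo-++ 2 (suc (suc n)) (λ t → colWeight (shape (4 + n) t) j2))
          (cong₂ _+_ (pair-col j2<B) (shapes-col-sum (suc (suc n)) (s≤s (s≤s z≤n)) j2<B))

module EvenFilling (a′ b′ M S : ℕ) .{{_ : NonZero M}} (2≤S : 2 ≤ S) where
  open GridReflections a′ b′
  open Band A B M S
  open Cyclic M using (_⊖_; ⊖<)

  σ σ⁻¹ : ℕ → Digits → Digits
  σ t (i1 , i2 , j2) = mirror M (odd (i2 + j2)) i1 , Y (shape S t) i2 j2 , X (shape S t) i2 j2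
  σ⁻¹ t (h , y , x) = mirror M (odd (i + j)) h , i , j
    where
    i = I (shape S t) y x
    j = J (shape S t) y x

  layers : LayerPermutation M A B
  layers = record
    { σ         = σ
    ; σ⁻¹       = σ⁻¹
    ; σ-range   = λ { t {i1 , i2 , j2} (i1<M , i2<A , j2<B) →
                    mirror< (odd (i2 + j2)) i1<M , Y< (shape S t) i2<A j2<B , X< (shape S t) i2<A j2<B }
    ; σ⁻¹-range = λ { t {h , y , x} (h<M , y<A , x<B) →
                    mirror< (odd (I (shape S t) y x + J (shape S t) y x)) h<M , I< (shape S t) y<A x<B , J< (shape S t) y<A x<B }
    ; σ⁻¹∘σ     = λ { t {i1 , i2 , j2} (i1<M , i2<A , j2<B) →
                    cong₃ (λ a b c → a , b , c)
                      (trans (cong (λ z → mirror M (odd z) (mirror M (odd (i2 + j2)) i1))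
                                   (cong₂ _+_ (I∘Y,X (shape S t) i2<A j2<B) (J∘Y,X (shape S t) i2<A j2<B)))
                             (mirror-involutive (odd (i2 + j2)) i1<M))
                      (I∘Y,X (shape S t) i2<A j2<B) (J∘Y,X (shape S t) i2<A j2<B) }
    ; σ∘σ⁻¹     = λ { t {h , y , x} (h<M , y<A , x<B) →
                    cong₃ (λ a b c → a , b , c)
                      (mirror-involutive (odd (I (shape S t) y x + J (shape S t) y x)) h<M)
                      (Y∘I,J (shape S t) y<A x<B) (X∘I,J (shape S t) y<A x<B) }
    }

  rowSum : ℕ
  rowSum = B * (sumTo S (λ t → t) * (M * A * B)) + S * (B′ * (M ∸ 1)) * (A * B) + rowTotal S

  row-sum : ∀ {i1 i2} → i1 < M → i2 < A → sumTo S (λ t → sumTo B (λ j2 → entry layers t (i1 , i2 , j2))) ≡ rowSum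
  row-sum {i1} {i2} i1<M i2<A = begin
    sumTo S (λ t → sumTo B (λ j2 → entry layers t (i1 , i2 , j2)))
      ≡⟨ sumTo-encode B (λ t j2 → σ t (i1 , i2 , j2)) ⟩
    B * (sumTo S (λ t → t) * (M * A * B))
      + sumTo S (λ _ → sumTo B (λ j2 → mirror M (odd (i2 + j2)) i1)) * (A * B)
      + sumTo S (λ t → rowWeight (shape S t) i2)
      ≡⟨ cong₂ (λ a b → B * (sumTo S (λ t → t) * (M * A * B)) + a * (A * B) + b)
               (trans (sumTo-const S _) (cong (S *_) checkerboard)) (shapes-row-sum S 2≤S i2<A) ⟩
    rowSum ∎
    where
    checkerboard : sumTo B (λ j2 → mirror M (odd (i2 + j2)) i1) ≡ B′ * (M ∸ 1)
    checkerboard = trans (sumTo-cong B (λ j2 _ → cong (λ z → mirror M (odd z) i1) (+-comm i2 j2)))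
                         (sumTo-mirror-odd B′ i2 i1<M)

  colSum : ℕ
  colSum = A * (sumTo S (λ t → t) * (M * A * B)) + S * (A′ * (M ∸ 1)) * (A * B) + colTotal S

  col-sum : ∀ {j1 j2} → j1 < M → j2 < B →
            sumTo S (λ t → sumTo A (λ i2 → entry layers t (j1 ⊖ t , i2 , j2))) ≡ colSum
  col-sum {j1} {j2} _ j2<B = begin
    sumTo S (λ t → sumTo A (λ i2 → entry layers t (j1 ⊖ t , i2 , j2)))
      ≡⟨ sumTo-encode A (λ t i2 → σ t (j1 ⊖ t , i2 , j2)) ⟩
    A * (sumTo S (λ t → t) * (M * A * B))
      + sumTo S (λ t → sumTo A (λ i2 → mirror M (odd (i2 + j2)) (j1 ⊖ t))) * (A * B)
      + sumTo S (λ t → colWeight (shape S t) j2)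
      ≡⟨ cong₂ (λ a b → A * (sumTo S (λ t → t) * (M * A * B)) + a * (A * B) + b)
               (trans (sumTo-cong S (λ t _ → sumTo-mirror-odd A′ j2 (⊖< j1 t))) (sumTo-const S _))
               (shapes-col-sum S 2≤S j2<B) ⟩
    colSum ∎

  magicRectangle : S ≤ M → MagicRectangle (A * M) (B * M) (B * S) (A * S)
  magicRectangle S≤M = Construction.magicRectangle S≤M record
    { layers = layers ; rowSum = rowSum ; colSum = colSum ; row-sum = row-sum ; col-sum = col-sum }

-- Reduction to the odd and the even construction

n%2≡0⊎n%2≡1 : ∀ n → n % 2 ≡ 0 ⊎ n % 2 ≡ 1
n%2≡0⊎n%2≡1 n with n % 2 | m%n<n n 2
... | 0 | _ = inj₁ refl
... | 1 | _ = inj₂ refl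
... | suc (suc _) | s≤s (s≤s ())

even-decompose : ∀ {n} → n % 2 ≡ 0 → 0 < n → ∃[ k ] n ≡ suc k * 2
even-decompose {n} n%2≡0 0<n with n / 2 | m≡m%n+[m/n]*n n 2
... | zero  | n≡ = ⊥-elim (<⇒≢ 0<n (sym (trans n≡ (cong (_+ 0) n%2≡0))))
... | suc k | n≡ = k , trans n≡ (cong (_+ suc k * 2) n%2≡0)

odd-decompose : ∀ {n} → n % 2 ≡ 1 → 1 < n → ∃[ g ] n ≡ suc (suc g + suc g)
odd-decompose {n} n%2≡1 1<n with n / 2 | m≡m%n+[m/n]*n n 2
... | zero  | n≡ = ⊥-elim (<⇒≢ 1<n (sym (trans n≡ (cong (_+ 0) n%2≡1))))
... | suc g | n≡ = g , trans n≡ (trans (cong (_+ suc g * 2) n%2≡1) (regroup g))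
  where
  regroup : ∀ g → 1 + suc g * 2 ≡ suc (suc g + suc g)
  regroup = solve-∀

subst-MagicRectangle : ∀ {m n r s m′ n′ r′ s′} → m ≡ m′ → n ≡ n′ → r ≡ r′ → s ≡ s′ →
                       MagicRectangle m n r s → MagicRectangle m′ n′ r′ s′
subst-MagicRectangle refl refl refl refl R = R

even-sides : ∀ {a b m s} → a % 2 ≡ 0 → b % 2 ≡ 0 → 1 < a → 1 < b → 2 ≤ s → s ≤ m →
             MagicRectangle (a * m) (b * m) (b * s) (a * s)
even-sides {a} {b} {m} {s} a-even b-even 1<a 1<b 2≤s s≤m
  with even-decompose a-even (<-trans z<s 1<a) | even-decompose b-even (<-trans z<s 1<b)
... | a′ , refl | b′ , refl = EvenFilling.magicRectangle a′ b′ m s {{>-nonZero (<-≤-trans (<-≤-trans z<s 2≤s) s≤m)}} 2≤s s≤m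

odd-sides-odd-m : ∀ {a b m s} → a % 2 ≡ 1 → b % 2 ≡ 1 → m % 2 ≡ 1 → 1 < a → 1 < b → 3 ≤ s → s ≤ m →
                  MagicRectangle (a * m) (b * m) (b * s) (a * s)
odd-sides-odd-m {a} {b} {m} {s} a-odd b-odd m-odd 1<a 1<b 3≤s s≤m
  with odd-decompose a-odd 1<a | odd-decompose b-odd 1<b | odd-decompose m-odd (<-≤-trans (s≤s (s≤s z≤n)) (≤-trans 3≤s s≤m))
... | gA , refl | gB , refl | gM , refl = OddFilling.magicRectangle gM gA gB s 3≤s s≤m

-- Halving m and s makes the sides 2a and 2b even, and 2a · (m/2) = a · m.
odd-sides-even-m : ∀ {a b m s} → a % 2 ≡ 1 → b % 2 ≡ 1 → m % 2 ≡ 0 → s % 2 ≡ 0 → 1 < a → 1 < b → 3 ≤ s → s ≤ m →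
                   MagicRectangle (a * m) (b * m) (b * s) (a * s)
odd-sides-even-m {a} {b} {m} {s} a-odd b-odd m-even s-even 1<a 1<b 3≤s s≤m
  with odd-decompose a-odd 1<a | odd-decompose b-odd 1<b
     | even-decompose m-even (<-≤-trans z<s (≤-trans 3≤s s≤m)) | even-decompose s-even (<-≤-trans z<s 3≤s)
... | gA , refl | gB , refl | m′ , refl | s′ , refl =
  subst-MagicRectangle (halve a m′) (halve b m′) (halve b s′) (halve a s′)
    (EvenFilling.magicRectangle (suc gA + suc gA) (suc gB + suc gB) (suc m′) (suc s′) 2≤s′ s′≤m′)
  where
  halve : ∀ x y → x * 2 * suc y ≡ x * (suc y * 2)
  halve x y = trans (*-assoc x 2 (suc y)) (cong (x *_) (*-comm 2 (suc y)))
  2≤s′ : 2 ≤ suc s′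
  2≤s′ = 3≤2k⇒2≤k s′ 3≤s
    where
    3≤2k⇒2≤k : ∀ k → 3 ≤ suc k * 2 → 2 ≤ suc k
    3≤2k⇒2≤k zero    (s≤s (s≤s ()))
    3≤2k⇒2≤k (suc k) _ = s≤s (s≤s z≤n)
  s′≤m′ : suc s′ ≤ suc m′
  s′≤m′ = *-cancelʳ-≤ (suc s′) (suc m′) 2 s≤m

corollary10 : (a b m s : ℕ) → 3 ≤ s → s ≤ m →
    (s % 2 ≡ 0 ⊎ m % 2 ≡ 1) →
    a % 2 ≡ b % 2 → 5 < a + b → 1 < a → 1 < b →
    MagicRectangle (a * m) (b * m) (b * s) (a * s)
-- 5 < a + b only excludes a = b = 2, which the even construction covers as well.
corollary10 a b m s 3≤s s≤m s-even⊎m-odd a≡b _ 1<a 1<b with n%2≡0⊎n%2≡1 a | n%2≡0⊎n%2≡1 m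
... | inj₁ a-even | _ = even-sides a-even (trans (sym a≡b) a-even) 1<a 1<b (≤-trans (n≤1+n 2) 3≤s) s≤m
... | inj₂ a-odd | inj₂ m-odd = odd-sides-odd-m a-odd (trans (sym a≡b) a-odd) m-odd 1<a 1<b 3≤s s≤m
... | inj₂ a-odd | inj₁ m-even = odd-sides-even-m a-odd (trans (sym a≡b) a-odd) m-even s-even 1<a 1<b 3≤s s≤m
  where
  s-even : s % 2 ≡ 0
  s-even = [ (λ s%2≡0 → s%2≡0) , (λ m-odd → ⊥-elim (0≢1+n (trans (sym m-even) m-odd))) ]′ s-even⊎m-odd
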